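{- Let $p$ be a prime number and $k,N$ positive integers. Suppose that integers $n,m\geq N$ satisfy $n\equiv m\pmod{\varphi(p^N)}$. Then \[ C^{(-k)}_{n}\equiv C^{(-k)}_{m}\pmod{p^{N}}. \]
   Context: For any integer $k$, let $\mathrm{Li}_k(t)=\sum_{n\geq 1} t^n/n^k$ (for $k\le 0$ this is a rational function of $t$). The poly-Bernoulli numbers of type $C$, $C^{(k)}_n$ ($n\ge 0$), are defined by \[ \frac{\mathrm{Li}_{k}(1-e^{ -t})}{e^{t}-1}=\sum_{n=0}^{\infty}C^{(k)}_{n}\frac{t^n}{n!}. \] For negative upper index these are integers. $\varphi$ denotes Euler's totient function, so $\varphi(p^N)=p^{N-1}(p-1)$. -}

module Defs where

open import Data.Nat as ℕ using (ℕ; zero; suc; _!)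
open import Data.Nat.Properties using (_!≢0)
open import Data.Nat.GCD using (gcd)
open import Data.Integer as ℤ using (ℤ)
open import Data.Rational as ℚ using (ℚ; 0ℚ; 1ℚ; _+_; _*_; _-_; -_; _/_)
open import Data.List using (List; []; _∷_; length; filter; upTo; map; zipWith; foldr)

sumℚ : List ℚ → ℚ
sumℚ = foldr _+_ 0ℚ

-- Euler's totient function: φ n = #{ i < n : gcd(i,n) = 1 }
-- (for n ≥ 1 this equals #{1 ≤ i ≤ n : gcd(i,n) = 1}).

φ : ℕ → ℕ
φ n = length (filter (λ i → gcd i n ℕ.≟ 1) (upTo n))

-- Formal power series over ℚ, by ordinary coefficients: f j = [t^j] f.

Series : Set
Series = ℕ → ℚ

ℤ→ℚ : ℤ → ℚ
ℤ→ℚ z = z / 1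

ℕ→ℚ : ℕ → ℚ
ℕ→ℚ n = ℤ.+ n / 1

invFact : ℕ → ℚ
invFact j = (ℤ.+ 1 / (j !)) {{j !≢0}}

Σ≤ : ℕ → (ℕ → ℚ) → ℚ
Σ≤ zero f = f 0
Σ≤ (suc j) f = Σ≤ j f + f (suc j)

_⊛_ : Series → Series → Series
(f ⊛ g) j = Σ≤ j (λ i → f i * g (j ℕ.∸ i))

_^ₛ_ : Series → ℕ → Series
f ^ₛ zero = λ { zero → 1ℚ ; (suc _) → 0ℚ }
f ^ₛ suc n = f ⊛ (f ^ₛ n)

sgn : ℕ → ℚ
sgn zero = 1ℚ
sgn (suc j) = - sgn j

expNeg : Series
expNeg j = sgn j * invFact j

oneMinusExpNeg : Series
oneMinusExpNeg zero = 0ℚ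
oneMinusExpNeg (suc j) = - expNeg (suc j)

-- Li_{-k}(1 - e^{-t}) = Σ_{n ≥ 1} n^k (1 - e^{-t})^n.
-- Since (1-e^{-t})^n has order n, the coefficient of t^j only
-- receives contributions from 1 ≤ n ≤ j (the n = 0 term is excluded).
LiNegComp : ℕ → Series
LiNegComp k j = Σ≤ j (λ n → term n)
  where
  term : ℕ → ℚ
  term zero = 0ℚ
  term (suc n) = ℕ→ℚ (suc n ℕ.^ k) * (oneMinusExpNeg ^ₛ suc n) j

-- e^t - 1 = t · E(t) with E j = 1/(j+1)!, E 0 = 1.
E : Series
E j = invFact (suc j)

-- Division of a series G with G 0 = 0 by e^t - 1:
-- G = (e^t - 1) F  ⟺  G' = E F  with G' j = G (j+1);
-- since E 0 = 1:  F j = G' j - Σ_{i=1}^{j} E i · F (j - i).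
-- divRev G j is the list [F j, F (j-1), …, F 0].
divRev : Series → ℕ → List ℚ
divRev G zero = G 1 ∷ []
divRev G (suc j) =
  (G (suc (suc j)) - sumℚ (zipWith _*_ (map (λ i → E (suc i)) (upTo (suc j))) prev))
    ∷ prev
  where
  prev = divRev G j

head0 : List ℚ → ℚ
head0 [] = 0ℚ
head0 (x ∷ _) = x

divByExpMinusOne : Series → Series
divByExpMinusOne G j = head0 (divRev G j)

-- Poly-Bernoulli numbers of type C with upper index -k:
--   Li_{-k}(1 - e^{-t}) / (e^t - 1) = Σ_n C^{(-k)}_n t^n / n!
polyBernoulliC : ℕ → ℕ → ℚ
polyBernoulliC k n = ℕ→ℚ (n !) * divByExpMinusOne (LiNegComp k) n

module Submission where

-- With u = 1 − e^{−t}, the operator θ = (e^t − 1)·d/dt satisfies θ(uⁿ) = n·uⁿ, because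
-- d/dt uⁿ = n·uⁿ⁻¹·e^{−t} and (e^t − 1)·e^{−t} = u.  Hence Li_{−(k+1)}(u) = θ(Li_{−k}(u)), and
-- starting from Li₀(u) = u/(1 − u) = e^t − 1, induction on k gives
-- Li_{−k}(u) = (e^t − 1)·Σ c·e^{at} for a finite family of integers c and naturals a, since
-- such sums are stable under multiplication by e^t − 1 and under d/dt.  Dividing by e^t − 1
-- yields C^{(−k)}_n = Σ c·aⁿ.  Finally aⁿ ≡ aᵐ (mod p^N) when n ≡ m (mod φ(p^N)) and n, m ≥ N:
-- if p ∣ a both sides vanish modulo p^N, and otherwise a^{φ(p^N)} ≡ 1 (mod p^N) by Fermat's
-- little theorem and repeated lifting of x ≡ 1 (mod p^j) to x^p ≡ 1 (mod p^{j+1}).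

open import Defs
open import Data.Nat as ℕ using (ℕ; zero; suc; _≤_; _<_; z≤n; s≤s; _!)
import Data.Nat.Properties as ℕP
open import Data.Nat.Combinatorics using (_C_; nC1≡n; nCk+nC[k+1]≡[n+1]C[k+1])
open import Data.Integer.Base as ℤ using (ℤ)
open import Data.List using (List; []; _∷_)
open import Data.Product using (_×_; _,_)
open import Data.Sum using (_⊎_; inj₁; inj₂)
open import Function using (_∘_; id)
open import Relation.Binary.PropositionalEquality

[1+k]*[1+n]C[1+k]≡[1+n]*nCk : ∀ n k → suc k ℕ.* (suc n C suc k) ≡ suc n ℕ.* (n C k)
[1+k]*[1+n]C[1+k]≡[1+n]*nCk zero    zero    = refl
[1+k]*[1+n]C[1+k]≡[1+n]*nCk zero    (suc k) = ℕP.*-zeroʳ (suc (suc k))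
[1+k]*[1+n]C[1+k]≡[1+n]*nCk (suc n) zero    =
  trans (ℕP.+-identityʳ _) (trans (nC1≡n (suc (suc n))) (sym (ℕP.*-identityʳ _)))
[1+k]*[1+n]C[1+k]≡[1+n]*nCk (suc n) (suc k) = begin
  suc (suc k) ℕ.* (suc (suc n) C suc (suc k))
    ≡⟨ cong (suc (suc k) ℕ.*_) (nCk+nC[k+1]≡[n+1]C[k+1] (suc n) (suc k)) ⟨
  suc (suc k) ℕ.* (A ℕ.+ B)
    ≡⟨ solve 3 (λ k a b → (con 1 :+ k) :* (a :+ b) := k :* a :+ a :+ (con 1 :+ k) :* b) refl (suc k) A B ⟩
  suc k ℕ.* A ℕ.+ A ℕ.+ suc (suc k) ℕ.* B
    ≡⟨ cong₂ (λ u v → u ℕ.+ A ℕ.+ v) ([1+k]*[1+n]C[1+k]≡[1+n]*nCk n k) ([1+k]*[1+n]C[1+k]≡[1+n]*nCk n (suc k)) ⟩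
  suc n ℕ.* (n C k) ℕ.+ A ℕ.+ suc n ℕ.* (n C suc k)
    ≡⟨ solve 4 (λ m a b c → m :* a :+ c :+ m :* b := c :+ m :* (a :+ b)) refl (suc n) (n C k) (n C suc k) A ⟩
  A ℕ.+ suc n ℕ.* (n C k ℕ.+ n C suc k)
    ≡⟨ cong (λ c → A ℕ.+ suc n ℕ.* c) (nCk+nC[k+1]≡[n+1]C[k+1] n k) ⟩
  suc (suc n) ℕ.* A ∎
  where
  open ≡-Reasoning
  open import Data.Nat.Solver using (module +-*-Solver)
  open +-*-Solver
  A = suc n C suc k
  B = suc n C suc (suc k)

-- (c , a) ∷ P stands for the exponential polynomial c·e^{at} + P.
ExpPoly : Set
ExpPoly = List (ℤ × ℕ)

powerSum : ExpPoly → ℕ → ℤ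
powerSum []            n = ℤ.0ℤ
powerSum ((c , a) ∷ P) n = c ℤ.* (ℤ.+ a) ℤ.^ n ℤ.+ powerSum P n

module PrimePowerCongruences where

  import Data.Nat.Divisibility as ℕD
  open import Data.Nat.Combinatorics using (nCn≡1; k>n⇒nCk≡0)
  open import Data.Nat.Primality
    using (Prime; ¬prime[1]; euclidsLemma; prime⇒irreducible; prime⇒nonZero)
  open import Data.Nat.GCD using (gcd; gcd-greatest)
  open import Data.Nat.Coprimality
    using (Coprime; coprime⇒gcd≡1; coprime-divisor) renaming (sym to Coprime-sym)
  open import Data.Integer.Base using (+_; 0ℤ; 1ℤ; _+_; _*_; _-_; _^_)
  import Data.Integer.Properties as ℤP
  import Data.Integer.Coprimality as ℤC
  open import Data.Integer.Divisibility using () renaming (_∣_ to _∣ᵤ_)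
  open import Data.Integer.Divisibility.Signed
    using (_∣_; divides; ∣ᵤ⇒∣; ∣⇒∣ᵤ; ∣-trans; ∣m∣n⇒∣m+n; ∣m∣n⇒∣m-n; ∣m⇒∣m*n; ∣n⇒∣m*n; ∣m⇒∣-m;
           *-monoʳ-∣; *-monoˡ-∣)
  open import Data.Integer.Solver using (module +-*-Solver)
  open import Data.List using (_++_; upTo; filter; length)
  import Data.List.Properties as List
  open import Relation.Nullary using (¬_; contradiction)
  open import Relation.Nullary.Decidable using (Dec; yes; no)
  open +-*-Solver

  ∣-respʳ-≡ : ∀ {d x y} → x ≡ y → d ∣ x → d ∣ y
  ∣-respʳ-≡ refl d∣x = d∣x

  1∣ : ∀ x → 1ℤ ∣ x
  1∣ x = divides x (sym (ℤP.*-identityʳ x))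

  *-pres-∣ : ∀ {a b c e} → a ∣ b → c ∣ e → a * c ∣ b * e
  *-pres-∣ {b = b} {c} a∣b c∣e = ∣-trans (*-monoˡ-∣ c a∣b) (*-monoʳ-∣ b c∣e)

  ∣-swap-diff : ∀ {d} x y → d ∣ x - y → d ∣ y - x
  ∣-swap-diff x y d∣x-y =
    ∣-respʳ-≡ (solve 2 (λ x y → :- (x :- y) := y :- x) refl x y) (∣m⇒∣-m d∣x-y)

  pos-^ : ∀ a n → + (a ℕ.^ n) ≡ (+ a) ^ n
  pos-^ a zero    = refl
  pos-^ a (suc n) = trans (ℤP.pos-* a (a ℕ.^ n)) (cong (+ a *_) (pos-^ a n))

  ^-mono-∣ : ∀ {d x : ℤ} {m n} → d ∣ x → m ≤ n → d ^ m ∣ x ^ n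
  ^-mono-∣ {x = x} {n = n} d∣x z≤n      = 1∣ (x ^ n)
  ^-mono-∣ d∣x (s≤s m≤n) = *-pres-∣ d∣x (^-mono-∣ d∣x m≤n)

  -- The binomial theorem and Fermat's little theorem

  Σ≤ᶻ : ℕ → (ℕ → ℤ) → ℤ
  Σ≤ᶻ zero    f = f 0
  Σ≤ᶻ (suc n) f = Σ≤ᶻ n f + f (suc n)

  Σ≤ᶻ-cong : ∀ n {f g : ℕ → ℤ} → (∀ i → f i ≡ g i) → Σ≤ᶻ n f ≡ Σ≤ᶻ n g
  Σ≤ᶻ-cong zero    f≗g = f≗g 0
  Σ≤ᶻ-cong (suc n) f≗g = cong₂ _+_ (Σ≤ᶻ-cong n f≗g) (f≗g (suc n))

  Σ≤ᶻ-distrib-+ : ∀ n (f g : ℕ → ℤ) → Σ≤ᶻ n (λ i → f i + g i) ≡ Σ≤ᶻ n f + Σ≤ᶻ n g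
  Σ≤ᶻ-distrib-+ zero    f g = refl
  Σ≤ᶻ-distrib-+ (suc n) f g = trans (cong (_+ (f (suc n) + g (suc n))) (Σ≤ᶻ-distrib-+ n f g))
    (solve 4 (λ a b c d → (a :+ b) :+ (c :+ d) := (a :+ c) :+ (b :+ d)) refl
      (Σ≤ᶻ n f) (Σ≤ᶻ n g) (f (suc n)) (g (suc n)))

  Σ≤ᶻ-*ˡ : ∀ n c (f : ℕ → ℤ) → Σ≤ᶻ n (λ i → c * f i) ≡ c * Σ≤ᶻ n f
  Σ≤ᶻ-*ˡ zero    c f = refl
  Σ≤ᶻ-*ˡ (suc n) c f = trans (cong (_+ c * f (suc n)) (Σ≤ᶻ-*ˡ n c f))
    (sym (ℤP.*-distribˡ-+ c (Σ≤ᶻ n f) (f (suc n))))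

  Σ≤ᶻ-head : ∀ n (f : ℕ → ℤ) → Σ≤ᶻ (suc n) f ≡ f 0 + Σ≤ᶻ n (λ i → f (suc i))
  Σ≤ᶻ-head zero    f = refl
  Σ≤ᶻ-head (suc n) f = trans (cong (_+ f (suc (suc n))) (Σ≤ᶻ-head n f)) (ℤP.+-assoc (f 0) _ _)

  ∣-Σ≤ᶻ : ∀ n {d} (f : ℕ → ℤ) → (∀ i → i ≤ n → d ∣ f i) → d ∣ Σ≤ᶻ n f
  ∣-Σ≤ᶻ zero    f d∣f = d∣f 0 z≤n
  ∣-Σ≤ᶻ (suc n) f d∣f =
    ∣m∣n⇒∣m+n (∣-Σ≤ᶻ n f (λ i i≤n → d∣f i (ℕP.m≤n⇒m≤1+n i≤n))) (d∣f (suc n) ℕP.≤-refl)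

  binomial-theorem : ∀ (x : ℤ) n → (x + 1ℤ) ^ n ≡ Σ≤ᶻ n (λ k → + (n C k) * x ^ k)
  binomial-theorem x zero    = refl
  binomial-theorem x (suc n) = begin
    (x + 1ℤ) * (x + 1ℤ) ^ n
      ≡⟨ cong ((x + 1ℤ) *_) (trans (binomial-theorem x n) S≡1+T) ⟩
    (x + 1ℤ) * (1ℤ + T)
      ≡⟨ solve 2 (λ x t → (x :+ con 1ℤ) :* (con 1ℤ :+ t) := con 1ℤ :+ (x :* (con 1ℤ :+ t) :+ t)) refl x T ⟩
    1ℤ + (x * (1ℤ + T) + T)
      ≡⟨ cong (λ s → 1ℤ + (x * s + T)) S≡1+T ⟨
    1ℤ + (x * S + T)
      ≡⟨ cong (λ s → 1ℤ + (s + T)) (Σ≤ᶻ-*ˡ n x f) ⟨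
    1ℤ + (Σ≤ᶻ n (λ k → x * f k) + T)
      ≡⟨ cong (λ s → 1ℤ + s) (Σ≤ᶻ-distrib-+ n (λ k → x * f k) (λ k → f (suc k))) ⟨
    1ℤ + Σ≤ᶻ n (λ k → x * f k + f (suc k))
      ≡⟨ cong (λ s → 1ℤ + s) (Σ≤ᶻ-cong n pascal) ⟩
    1ℤ + Σ≤ᶻ n (λ k → g (suc k))
      ≡⟨ Σ≤ᶻ-head n g ⟨
    Σ≤ᶻ (suc n) g ∎
    where
    open ≡-Reasoning
    f g : ℕ → ℤ
    f k = + (n C k) * x ^ k
    g k = + (suc n C k) * x ^ k
    S = Σ≤ᶻ n f
    T = Σ≤ᶻ n (λ k → f (suc k))
    S≡1+T : S ≡ 1ℤ + T
    S≡1+T = begin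
      S                  ≡⟨ ℤP.+-identityʳ S ⟨
      S + 0ℤ             ≡⟨ cong (λ c → S + + c * x ^ suc n) (k>n⇒nCk≡0 (ℕP.n<1+n n)) ⟨
      Σ≤ᶻ (suc n) f      ≡⟨ Σ≤ᶻ-head n f ⟩
      1ℤ * 1ℤ + T        ∎
    pascal : ∀ k → x * f k + f (suc k) ≡ g (suc k)
    pascal k = begin
      x * (+ (n C k) * x ^ k) + + (n C suc k) * (x * x ^ k)
        ≡⟨ solve 4 (λ x a b y → x :* (a :* y) :+ b :* (x :* y) := (a :+ b) :* (x :* y))
             refl x (+ (n C k)) (+ (n C suc k)) (x ^ k) ⟩
      (+ (n C k) + + (n C suc k)) * x ^ suc k
        ≡⟨ cong (_* x ^ suc k) (trans (sym (ℤP.pos-+ (n C k) (n C suc k))) (cong +_ (nCk+nC[k+1]≡[n+1]C[k+1] n k))) ⟩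
      g (suc k) ∎


  prime∣C : ∀ {p k} → Prime p → 0 < k → k < p → p ℕD.∣ p C k
  prime∣C {suc n} {suc k} pp _ k<p
    with euclidsLemma (suc k) (suc n C suc k) pp
           (subst (suc n ℕD.∣_) (sym ([1+k]*[1+n]C[1+k]≡[1+n]*nCk n k)) (ℕD.m∣m*n (n C k)))
  ... | inj₁ p∣1+k = contradiction (ℕD.∣⇒≤ p∣1+k) (ℕP.<⇒≱ k<p)
  ... | inj₂ p∣C   = p∣C

  prime∣[x+1]^p-x^p-1 : ∀ {p} x → Prime p → + p ∣ (x + 1ℤ) ^ p - x ^ p - 1ℤ
  prime∣[x+1]^p-x^p-1 {p = suc (suc m)} x pp =
    ∣-respʳ-≡ (sym middle-terms) (∣-Σ≤ᶻ m (λ i → f (suc i)) λ i i≤m →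
      ∣m⇒∣m*n {m = + (p C suc i)} (x ^ suc i) (∣ᵤ⇒∣ (prime∣C pp (s≤s z≤n) (s≤s (s≤s i≤m)))))
    where
    open ≡-Reasoning
    p = suc (suc m)
    f : ℕ → ℤ
    f k = + (p C k) * x ^ k
    M = Σ≤ᶻ m (λ i → f (suc i))
    middle-terms : (x + 1ℤ) ^ p - x ^ p - 1ℤ ≡ M
    middle-terms = begin
      (x + 1ℤ) ^ p - x ^ p - 1ℤ
        ≡⟨ cong (λ s → s - x ^ p - 1ℤ) (binomial-theorem x p) ⟩
      Σ≤ᶻ (suc m) f + f p - x ^ p - 1ℤ
        ≡⟨ cong (λ s → s + f p - x ^ p - 1ℤ) (Σ≤ᶻ-head m f) ⟩
      1ℤ + M + f p - x ^ p - 1ℤ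
        ≡⟨ cong (λ c → 1ℤ + M + + c * x ^ p - x ^ p - 1ℤ) (nCn≡1 p) ⟩
      1ℤ + M + 1ℤ * x ^ p - x ^ p - 1ℤ
        ≡⟨ solve 2 (λ m y → con 1ℤ :+ m :+ con 1ℤ :* y :- y :- con 1ℤ := m) refl M (x ^ p) ⟩
      M ∎

  fermat : ∀ {p} → Prime p → ∀ a → + p ∣ (+ a) ^ p - + a
  fermat {suc _} pp zero    = divides 0ℤ refl
  fermat {p}     pp (suc a) = ∣-respʳ-≡ (sym split) (∣m∣n⇒∣m+n (prime∣[x+1]^p-x^p-1 (+ a) pp) (fermat pp a))
    where
    split : (+ suc a) ^ p - + suc a ≡ ((+ a + 1ℤ) ^ p - (+ a) ^ p - 1ℤ) + ((+ a) ^ p - + a)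
    split = begin
      (+ suc a) ^ p - + suc a
        ≡⟨ cong (λ z → z ^ p - z) (ℤP.+-comm 1ℤ (+ a)) ⟩
      (+ a + 1ℤ) ^ p - (+ a + 1ℤ)
        ≡⟨ solve 3 (λ y z a → y :- (a :+ con 1ℤ) := (y :- z :- con 1ℤ) :+ (z :- a))
             refl ((+ a + 1ℤ) ^ p) ((+ a) ^ p) (+ a) ⟩
      ((+ a + 1ℤ) ^ p - (+ a) ^ p - 1ℤ) + ((+ a) ^ p - + a) ∎
      where open ≡-Reasoning

  ∤⇒coprime : ∀ {p a} → Prime p → ¬ p ℕD.∣ a → Coprime p a
  ∤⇒coprime pp p∤a (d∣p , d∣a) with prime⇒irreducible pp d∣p
  ... | inj₁ d≡1 = d≡1
  ... | inj₂ refl = contradiction d∣a p∤a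

  coprime-^ʳ : ∀ {a p} K → Coprime a p → Coprime a (p ℕ.^ K)
  coprime-^ʳ zero    a⊥p (_ , d∣1) = ℕD.∣1⇒≡1 d∣1
  coprime-^ʳ {a} {p} (suc K) a⊥p {d} (d∣a , d∣p^1+K) =
    coprime-^ʳ K a⊥p (d∣a , coprime-divisor d⊥p d∣p^1+K)
    where
    d⊥p : Coprime d p
    d⊥p (c∣d , c∣p) = a⊥p (ℕD.∣-trans c∣d d∣a , c∣p)

  fermat-∤ : ∀ {p a} → Prime p → ¬ p ℕD.∣ a → + p ∣ (+ a) ^ (p ℕ.∸ 1) - 1ℤ
  fermat-∤ {suc q} {a} pp p∤a =
    ∣ᵤ⇒∣ (ℤC.coprime-divisor (+ suc q) (+ a) _ (∤⇒coprime pp p∤a) (∣⇒∣ᵤ (∣-respʳ-≡ factor (fermat pp a))))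
    where
    factor : (+ a) ^ suc q - + a ≡ + a * ((+ a) ^ q - 1ℤ)
    factor = solve 2 (λ a y → a :* y :- a := a :* (y :- con 1ℤ)) refl (+ a) ((+ a) ^ q)

  -- Euler's theorem for prime powers

  geometric : ℤ → ℕ → ℤ
  geometric x zero    = 0ℤ
  geometric x (suc n) = 1ℤ + x * geometric x n

  x^n-1≡geometric*[x-1] : ∀ x n → x ^ n - 1ℤ ≡ geometric x n * (x - 1ℤ)
  x^n-1≡geometric*[x-1] x zero    = refl
  x^n-1≡geometric*[x-1] x (suc n) = begin
    x * x ^ n - 1ℤ
      ≡⟨ solve 2 (λ x y → x :* y :- con 1ℤ := x :* (y :- con 1ℤ) :+ (x :- con 1ℤ)) refl x (x ^ n) ⟩
    x * (x ^ n - 1ℤ) + (x - 1ℤ)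
      ≡⟨ cong (λ z → x * z + (x - 1ℤ)) (x^n-1≡geometric*[x-1] x n) ⟩
    x * (geometric x n * (x - 1ℤ)) + (x - 1ℤ)
      ≡⟨ solve 2 (λ x g → x :* (g :* (x :- con 1ℤ)) :+ (x :- con 1ℤ) := (con 1ℤ :+ x :* g) :* (x :- con 1ℤ))
           refl x (geometric x n) ⟩
    geometric x (suc n) * (x - 1ℤ) ∎
    where open ≡-Reasoning

  ∣x-1⇒∣x^n-1 : ∀ {d x} n → d ∣ x - 1ℤ → d ∣ x ^ n - 1ℤ
  ∣x-1⇒∣x^n-1 {x = x} n d∣x-1 = ∣-respʳ-≡ (sym (x^n-1≡geometric*[x-1] x n)) (∣n⇒∣m*n (geometric x n) d∣x-1)

  ∣x-1⇒∣geometric-n : ∀ {d x} n → d ∣ x - 1ℤ → d ∣ geometric x n - + n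
  ∣x-1⇒∣geometric-n {d} zero _ = divides 0ℤ (sym (ℤP.*-zeroˡ d))
  ∣x-1⇒∣geometric-n {x = x} (suc n) d∣x-1 =
    ∣-respʳ-≡ (sym step) (∣m∣n⇒∣m+n (∣n⇒∣m*n x (∣x-1⇒∣geometric-n n d∣x-1)) (∣n⇒∣m*n (+ n) d∣x-1))
    where
    step : geometric x (suc n) - + suc n ≡ x * (geometric x n - + n) + + n * (x - 1ℤ)
    step = begin
      1ℤ + x * geometric x n - + suc n
        ≡⟨ cong (λ z → 1ℤ + x * geometric x n - z) (ℤP.pos-+ 1 n) ⟩
      1ℤ + x * geometric x n - (1ℤ + + n)
        ≡⟨ solve 3 (λ x g n → con 1ℤ :+ x :* g :- (con 1ℤ :+ n) := x :* (g :- n) :+ n :* (x :- con 1ℤ))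
             refl x (geometric x n) (+ n) ⟩
      x * (geometric x n - + n) + + n * (x - 1ℤ) ∎
      where open ≡-Reasoning

  lift-∣x^p-1 : ∀ {p j x} → (+ p) ^ suc j ∣ x - 1ℤ → (+ p) ^ suc (suc j) ∣ x ^ p - 1ℤ
  lift-∣x^p-1 {p} {j} {x} p^j+1∣x-1 =
    ∣-respʳ-≡ (sym (x^n-1≡geometric*[x-1] x p)) (*-pres-∣ p∣geometric p^j+1∣x-1)
    where
    p∣x-1 : + p ∣ x - 1ℤ
    p∣x-1 = ∣-trans (∣m⇒∣m*n ((+ p) ^ j) (divides 1ℤ (sym (ℤP.*-identityˡ (+ p))))) p^j+1∣x-1
    p∣geometric : + p ∣ geometric x p
    p∣geometric = ∣-respʳ-≡ (solve 2 (λ g p → g :- p :+ p := g) refl (geometric x p) (+ p))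
      (∣m∣n⇒∣m+n (∣x-1⇒∣geometric-n p p∣x-1) (divides 1ℤ (sym (ℤP.*-identityˡ (+ p)))))

  p^[1+j]∣a^[[p∸1]p^j]-1 : ∀ {p a} → Prime p → ¬ p ℕD.∣ a → ∀ j →
                      (+ p) ^ suc j ∣ (+ a) ^ ((p ℕ.∸ 1) ℕ.* p ℕ.^ j) - 1ℤ
  p^[1+j]∣a^[[p∸1]p^j]-1 {p} {a} pp p∤a zero =
    subst₂ (λ d e → d ∣ (+ a) ^ e - 1ℤ) (sym (ℤP.*-identityʳ (+ p))) (sym (ℕP.*-identityʳ (p ℕ.∸ 1)))
      (fermat-∤ pp p∤a)
  p^[1+j]∣a^[[p∸1]p^j]-1 {p} {a} pp p∤a (suc j) =
    subst (λ y → (+ p) ^ suc (suc j) ∣ y - 1ℤ) (trans (ℤP.^-*-assoc (+ a) e p) (cong ((+ a) ^_) exponent))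
      (lift-∣x^p-1 {p} {j} (p^[1+j]∣a^[[p∸1]p^j]-1 pp p∤a j))
    where
    e = (p ℕ.∸ 1) ℕ.* p ℕ.^ j
    exponent : e ℕ.* p ≡ (p ℕ.∸ 1) ℕ.* p ℕ.^ suc j
    exponent = trans (ℕP.*-assoc (p ℕ.∸ 1) (p ℕ.^ j) p) (cong ((p ℕ.∸ 1) ℕ.*_) (ℕP.*-comm (p ℕ.^ j) p))

  -- The totient of a prime power

  coprime-to? : ∀ M i → Dec (gcd i M ≡ 1)
  coprime-to? M i = gcd i M ℕ.≟ 1

  totatives< : ℕ → ℕ → ℕ
  totatives< M n = length (filter (coprime-to? M) (upTo n))

  totatives<-suc : ∀ M n → totatives< M (suc n) ≡ totatives< M n ℕ.+ length (filter (coprime-to? M) (n ∷ []))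
  totatives<-suc M n = begin
    length (filter P? (upTo (suc n)))                  ≡⟨ cong (λ l → length (filter P? l)) (List.upTo-∷ʳ n) ⟨
    length (filter P? (upTo n ++ n ∷ []))              ≡⟨ cong length (List.filter-++ P? (upTo n) (n ∷ [])) ⟩
    length (filter P? (upTo n) ++ filter P? (n ∷ []))  ≡⟨ List.length-++ (filter P? (upTo n)) ⟩
    totatives< M n ℕ.+ length (filter P? (n ∷ []))     ∎
    where
    open ≡-Reasoning
    P? = coprime-to? M

  totatives<-suc-coprime : ∀ {M n} → gcd n M ≡ 1 → totatives< M (suc n) ≡ suc (totatives< M n)
  totatives<-suc-coprime {M} {n} n⊥M = trans (totatives<-suc M n)
    (trans (cong (λ l → totatives< M n ℕ.+ length l) 
      (List.filter-accept (coprime-to? M) {x = n} {xs = []} n⊥M))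
      (ℕP.+-comm (totatives< M n) 1))

  totatives<-suc-¬coprime : ∀ {M n} → gcd n M ≢ 1 → totatives< M (suc n) ≡ totatives< M n
  totatives<-suc-¬coprime {M} {n} n⊥̸M = trans (totatives<-suc M n)
    (trans (cong (λ l → totatives< M n ℕ.+ length l) 
      (List.filter-reject (coprime-to? M) {x = n} {xs = []} n⊥̸M))
      (ℕP.+-identityʳ (totatives< M n)))

  module _ {p} (pp : Prime p) (K : ℕ) where

    private
      M = p ℕ.^ suc K
      1+[p∸1]≡p : suc (p ℕ.∸ 1) ≡ p
      1+[p∸1]≡p = ℕP.m+[n∸m]≡n (ℕ.>-nonZero⁻¹ p {{prime⇒nonZero pp}})

    ∣⇒gcd≢1 : ∀ {i} → p ℕD.∣ i → gcd i M ≢ 1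
    ∣⇒gcd≢1 p∣i gcd≡1 = ¬prime[1] (subst Prime p≡1 pp)
      where
      p≡1 = ℕD.∣1⇒≡1 (subst (p ℕD.∣_) gcd≡1 (gcd-greatest p∣i (ℕD.m∣m*n (p ℕ.^ K))))

    ∤⇒gcd≡1 : ∀ {i} → ¬ p ℕD.∣ i → gcd i M ≡ 1
    ∤⇒gcd≡1 p∤i = coprime⇒gcd≡1 (coprime-^ʳ (suc K) (Coprime-sym (∤⇒coprime pp p∤i)))

    totatives<-block : ∀ t r → r < p → totatives< M (p ℕ.* t ℕ.+ suc r) ≡ totatives< M (p ℕ.* t) ℕ.+ r
    totatives<-block t zero    _   = trans (cong (totatives< M) (ℕP.+-comm (p ℕ.* t) 1))
      (trans (totatives<-suc-¬coprime {M} {p ℕ.* t} (∣⇒gcd≢1 (ℕD.m∣m*n t))) (sym (ℕP.+-identityʳ _)))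
    totatives<-block t (suc r) r<p = begin
      totatives< M (p ℕ.* t ℕ.+ suc (suc r))
        ≡⟨ cong (totatives< M) (ℕP.+-suc (p ℕ.* t) (suc r)) ⟩
      totatives< M (suc (p ℕ.* t ℕ.+ suc r))
        ≡⟨ totatives<-suc-coprime {M} (∤⇒gcd≡1 p∤pt+r) ⟩
      suc (totatives< M (p ℕ.* t ℕ.+ suc r))
        ≡⟨ cong suc (totatives<-block t r (ℕP.<-trans (ℕP.n<1+n r) r<p)) ⟩
      suc (totatives< M (p ℕ.* t) ℕ.+ r)
        ≡⟨ ℕP.+-suc (totatives< M (p ℕ.* t)) r ⟨
      totatives< M (p ℕ.* t) ℕ.+ suc r ∎
      where
      open ≡-Reasoning
      p∤pt+r : ¬ p ℕD.∣ p ℕ.* t ℕ.+ suc r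
      p∤pt+r p∣ = ℕP.<⇒≱ r<p (ℕD.∣⇒≤ (ℕD.∣m+n∣m⇒∣n p∣ (ℕD.m∣m*n t)))

    totatives<-multiple : ∀ t → totatives< M (p ℕ.* t) ≡ (p ℕ.∸ 1) ℕ.* t
    totatives<-multiple zero = trans (cong (totatives< M) (ℕP.*-zeroʳ p)) (sym (ℕP.*-zeroʳ (p ℕ.∸ 1)))
    totatives<-multiple (suc t) = begin
      totatives< M (p ℕ.* suc t)
        ≡⟨ cong (totatives< M) p[1+t]≡pt+p ⟩
      totatives< M (p ℕ.* t ℕ.+ suc (p ℕ.∸ 1))
        ≡⟨ totatives<-block t (p ℕ.∸ 1) (subst (p ℕ.∸ 1 <_) 1+[p∸1]≡p ℕP.≤-refl) ⟩
      totatives< M (p ℕ.* t) ℕ.+ (p ℕ.∸ 1)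
        ≡⟨ cong (ℕ._+ (p ℕ.∸ 1)) (totatives<-multiple t) ⟩
      (p ℕ.∸ 1) ℕ.* t ℕ.+ (p ℕ.∸ 1)
        ≡⟨ trans (ℕP.+-comm ((p ℕ.∸ 1) ℕ.* t) (p ℕ.∸ 1)) (sym (ℕP.*-suc (p ℕ.∸ 1) t)) ⟩
      (p ℕ.∸ 1) ℕ.* suc t ∎
      where
      open ≡-Reasoning
      p[1+t]≡pt+p : p ℕ.* suc t ≡ p ℕ.* t ℕ.+ suc (p ℕ.∸ 1)
      p[1+t]≡pt+p = trans (ℕP.*-suc p t) (trans (ℕP.+-comm p (p ℕ.* t))
        (cong (p ℕ.* t ℕ.+_) (sym 1+[p∸1]≡p)))

  φ-prime-power : ∀ {p} → Prime p → ∀ K → φ (p ℕ.^ suc K) ≡ (p ℕ.∸ 1) ℕ.* p ℕ.^ K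
  φ-prime-power {p} pp K = totatives<-multiple pp K (p ℕ.^ K)

  -- Periodicity of powers modulo p^N

  euler-prime-power : ∀ {p a} → Prime p → ¬ p ℕD.∣ a → ∀ N → (+ p) ^ N ∣ (+ a) ^ φ (p ℕ.^ N) - 1ℤ
  euler-prime-power pp p∤a zero = 1∣ _
  euler-prime-power {p} {a} pp p∤a (suc j) =
    subst (λ e → (+ p) ^ suc j ∣ (+ a) ^ e - 1ℤ) (sym (φ-prime-power pp j)) (p^[1+j]∣a^[[p∸1]p^j]-1 pp p∤a j)

  ^-periodic : ∀ {p N k} → Prime p → N ≤ k → ∀ a t →
                 (+ p) ^ N ∣ (+ a) ^ (k ℕ.+ φ (p ℕ.^ N) ℕ.* t) - (+ a) ^ k
  ^-periodic {p} {N} {k} pp N≤k a t with p ℕD.∣? a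
  ... | yes p∣a = ∣m∣n⇒∣m-n (^-mono-∣ (∣ᵤ⇒∣ p∣a) (ℕP.≤-trans N≤k (ℕP.m≤m+n k _))) (^-mono-∣ (∣ᵤ⇒∣ p∣a) N≤k)
  ... | no  p∤a = ∣-respʳ-≡ (sym factor) (∣n⇒∣m*n ((+ a) ^ k) (∣x-1⇒∣x^n-1 t (euler-prime-power pp p∤a N)))
    where
    e = φ (p ℕ.^ N)
    factor : (+ a) ^ (k ℕ.+ e ℕ.* t) - (+ a) ^ k ≡ (+ a) ^ k * (((+ a) ^ e) ^ t - 1ℤ)
    factor = begin
      (+ a) ^ (k ℕ.+ e ℕ.* t) - (+ a) ^ k
        ≡⟨ cong (_- (+ a) ^ k) (ℤP.^-distribˡ-+-* (+ a) k (e ℕ.* t)) ⟩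
      (+ a) ^ k * (+ a) ^ (e ℕ.* t) - (+ a) ^ k
        ≡⟨ cong (λ y → (+ a) ^ k * y - (+ a) ^ k) (ℤP.^-*-assoc (+ a) e t) ⟨
      (+ a) ^ k * ((+ a) ^ e) ^ t - (+ a) ^ k
        ≡⟨ solve 2 (λ u v → u :* v :- u := u :* (v :- con 1ℤ)) refl ((+ a) ^ k) (((+ a) ^ e) ^ t) ⟩
      (+ a) ^ k * (((+ a) ^ e) ^ t - 1ℤ) ∎
      where open ≡-Reasoning

  ∣-powerSum : ∀ {d n m} → (∀ a → d ∣ (+ a) ^ n - (+ a) ^ m) → ∀ P → d ∣ powerSum P n - powerSum P m
  ∣-powerSum {d} d∣ []            = divides 0ℤ (sym (ℤP.*-zeroˡ d))
  ∣-powerSum {n = n} {m} d∣ ((c , a) ∷ P) =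
    ∣-respʳ-≡ (sym regroup) (∣m∣n⇒∣m+n (∣n⇒∣m*n c (d∣ a)) (∣-powerSum d∣ P))
    where
    regroup : powerSum ((c , a) ∷ P) n - powerSum ((c , a) ∷ P) m
              ≡ c * ((+ a) ^ n - (+ a) ^ m) + (powerSum P n - powerSum P m)
    regroup = solve 5 (λ c x y r s → c :* x :+ r :- (c :* y :+ s) := c :* (x :- y) :+ (r :- s)) refl
      c ((+ a) ^ n) ((+ a) ^ m) (powerSum P n) (powerSum P m)

  private
    ∣+n-+m∣≡n∸m : ∀ {m n} → m ≤ n → ℤ.∣ + n - + m ∣ ≡ n ℕ.∸ m
    ∣+n-+m∣≡n∸m {m} {n} m≤n = cong ℤ.∣_∣ (trans (ℤP.m-n≡m⊖n n m) (ℤP.⊖-≥ m≤n))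

    ^-≡-mod-prime-power-≤ : ∀ {p N m n} → Prime p → N ≤ m → m ≤ n → φ (p ℕ.^ N) ℕD.∣ n ℕ.∸ m →
                            ∀ a → (+ p) ^ N ∣ (+ a) ^ n - (+ a) ^ m
    ^-≡-mod-prime-power-≤ {p} {N} {m} {n} pp N≤m m≤n (ℕD.divides t n∸m≡tφ) a =
      subst (λ e → (+ p) ^ N ∣ (+ a) ^ e - (+ a) ^ m) m+φt≡n (^-periodic pp N≤m a t)
      where
      m+φt≡n : m ℕ.+ φ (p ℕ.^ N) ℕ.* t ≡ n
      m+φt≡n = trans (cong (m ℕ.+_) (trans (ℕP.*-comm (φ (p ℕ.^ N)) t) (sym n∸m≡tφ))) (ℕP.m+[n∸m]≡n m≤n)

  ^-≡-mod-prime-power : ∀ {p N m n} → Prime p → N ≤ m → N ≤ n → + φ (p ℕ.^ N) ∣ᵤ + n - + m →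
                        ∀ a → + (p ℕ.^ N) ∣ (+ a) ^ n - (+ a) ^ m
  ^-≡-mod-prime-power {p} {N} {m} {n} pp N≤m N≤n φ∣n-m a =
    subst (_∣ (+ a) ^ n - (+ a) ^ m) (sym (pos-^ p N)) (by-order (ℕP.≤-total m n))
    where
    by-order : m ≤ n ⊎ n ≤ m → (+ p) ^ N ∣ (+ a) ^ n - (+ a) ^ m
    by-order (inj₁ m≤n) = ^-≡-mod-prime-power-≤ pp N≤m m≤n (subst (_ ℕD.∣_) (∣+n-+m∣≡n∸m m≤n) φ∣n-m) a
    by-order (inj₂ n≤m) = ∣-swap-diff ((+ a) ^ m) ((+ a) ^ n) (^-≡-mod-prime-power-≤ pp N≤n n≤m
      (subst (_ ℕD.∣_) (trans (ℤP.∣i-j∣≡∣j-i∣ (+ n) (+ m)) (∣+n-+m∣≡n∸m n≤m)) φ∣n-m) a)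

module PolyBernoulliClosedForm where

  open import Data.Nat.Properties using (_!≢0)
  import Data.Integer.Properties as ℤP
  open import Data.Rational.Base as ℚ using (ℚ; 0ℚ; 1ℚ; _+_; _*_; _-_; -_; fromℚᵘ)
  import Data.Rational.Properties as ℚP
  open import Data.Rational.Unnormalised.Base as ℚᵘ using (mkℚᵘ; *≡*)
  import Data.Rational.Unnormalised.Properties as ℚᵘP
  open import Data.Rational.Solver using (module +-*-Solver)
  open +-*-Solver using (solve; _:=_; _:+_; _:*_; _:-_; :-_; con)
  open import Data.List using (applyUpTo; map; upTo; zipWith)
  import Data.List.Properties as List
  open import Algebra.Definitions.RawSemiring ℚ.+-*-rawSemiring using (_^_)

  fromℚᵘ-homo-* : ∀ x y → fromℚᵘ (x ℚᵘ.* y) ≡ fromℚᵘ x * fromℚᵘ y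
  fromℚᵘ-homo-* x y = ℚP.toℚᵘ-injective (ℚᵘP.≃-trans (ℚP.toℚᵘ-fromℚᵘ (x ℚᵘ.* y))
    (ℚᵘP.≃-sym (ℚᵘP.≃-trans (ℚP.toℚᵘ-homo-* (fromℚᵘ x) (fromℚᵘ y))
      (ℚᵘP.*-cong (ℚP.toℚᵘ-fromℚᵘ x) (ℚP.toℚᵘ-fromℚᵘ y)))))

  fromℚᵘ-homo-+ : ∀ x y → fromℚᵘ (x ℚᵘ.+ y) ≡ fromℚᵘ x + fromℚᵘ y
  fromℚᵘ-homo-+ x y = ℚP.toℚᵘ-injective (ℚᵘP.≃-trans (ℚP.toℚᵘ-fromℚᵘ (x ℚᵘ.+ y))
    (ℚᵘP.≃-sym (ℚᵘP.≃-trans (ℚP.toℚᵘ-homo-+ (fromℚᵘ x) (fromℚᵘ y))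
      (ℚᵘP.+-cong (ℚP.toℚᵘ-fromℚᵘ x) (ℚP.toℚᵘ-fromℚᵘ y)))))

  fromℚᵘ-homo‿- : ∀ x → fromℚᵘ (ℚᵘ.- x) ≡ - fromℚᵘ x
  fromℚᵘ-homo‿- x = ℚP.toℚᵘ-injective (ℚᵘP.≃-trans (ℚP.toℚᵘ-fromℚᵘ (ℚᵘ.- x))
    (ℚᵘP.≃-sym (ℚᵘP.≃-trans (ℚP.toℚᵘ-homo‿- (fromℚᵘ x)) (ℚᵘP.-‿cong (ℚP.toℚᵘ-fromℚᵘ x)))))

  ℤ→ℚ-homo-* : ∀ a b → ℤ→ℚ (a ℤ.* b) ≡ ℤ→ℚ a * ℤ→ℚ b
  ℤ→ℚ-homo-* a b = fromℚᵘ-homo-* (mkℚᵘ a 0) (mkℚᵘ b 0)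

  ℤ→ℚ-homo-+ : ∀ a b → ℤ→ℚ (a ℤ.+ b) ≡ ℤ→ℚ a + ℤ→ℚ b
  ℤ→ℚ-homo-+ a b = trans (ℚP.fromℚᵘ-cong {mkℚᵘ (a ℤ.+ b) 0} {mkℚᵘ a 0 ℚᵘ.+ mkℚᵘ b 0}
      (*≡* (cong₂ (λ u v → (u ℤ.+ v) ℤ.* ℤ.+ 1) (sym (ℤP.*-identityʳ a)) (sym (ℤP.*-identityʳ b)))))
    (fromℚᵘ-homo-+ (mkℚᵘ a 0) (mkℚᵘ b 0))

  ℤ→ℚ-homo-- : ∀ a b → ℤ→ℚ (a ℤ.- b) ≡ ℤ→ℚ a - ℤ→ℚ b
  ℤ→ℚ-homo-- a b = trans (ℤ→ℚ-homo-+ a (ℤ.- b)) (cong (λ z → ℤ→ℚ a + z) (fromℚᵘ-homo‿- (mkℚᵘ b 0)))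

  ℕ→ℚ-homo-+ : ∀ m n → ℕ→ℚ (m ℕ.+ n) ≡ ℕ→ℚ m + ℕ→ℚ n
  ℕ→ℚ-homo-+ m n = trans (cong ℤ→ℚ (ℤP.pos-+ m n)) (ℤ→ℚ-homo-+ (ℤ.+ m) (ℤ.+ n))

  ℕ→ℚ-homo-* : ∀ m n → ℕ→ℚ (m ℕ.* n) ≡ ℕ→ℚ m * ℕ→ℚ n
  ℕ→ℚ-homo-* m n = trans (cong ℤ→ℚ (ℤP.pos-* m n)) (ℤ→ℚ-homo-* (ℤ.+ m) (ℤ.+ n))

  ℤ→ℚ-homo-^ : ∀ x n → ℤ→ℚ (x ℤ.^ n) ≡ ℤ→ℚ x ^ n
  ℤ→ℚ-homo-^ x zero    = refl
  ℤ→ℚ-homo-^ x (suc n) = trans (ℤ→ℚ-homo-* x (x ℤ.^ n)) (cong (ℤ→ℚ x *_) (ℤ→ℚ-homo-^ x n))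

  private
    invFact≡fromℚᵘ : ∀ j → invFact j ≡ fromℚᵘ (mkℚᵘ (ℤ.+ 1) (ℕ.pred (j !)))
    invFact≡fromℚᵘ j =
      ℚP./-cong {ℤ.+ 1} {j !} {ℤ.+ 1} {suc (ℕ.pred (j !))} {{j !≢0}} refl (sym (ℕP.suc-pred (j !) {{j !≢0}}))

  [1+j]*invFact[1+j]≡invFact[j] : ∀ j → ℕ→ℚ (suc j) * invFact (suc j) ≡ invFact j
  [1+j]*invFact[1+j]≡invFact[j] j = begin
    ℕ→ℚ (suc j) * invFact (suc j)      ≡⟨ cong (ℕ→ℚ (suc j) *_) (invFact≡fromℚᵘ (suc j)) ⟩
    fromℚᵘ [1+j] * fromℚᵘ [1/[1+j]!]   ≡⟨ fromℚᵘ-homo-* [1+j] [1/[1+j]!] ⟨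
    fromℚᵘ ([1+j] ℚᵘ.* [1/[1+j]!])     ≡⟨ ℚP.fromℚᵘ-cong {[1+j] ℚᵘ.* [1/[1+j]!]} {[1/j!]} (*≡* cross) ⟩
    fromℚᵘ [1/j!]                      ≡⟨ invFact≡fromℚᵘ j ⟨
    invFact j                          ∎
    where
    open ≡-Reasoning
    [1+j] = mkℚᵘ (ℤ.+ suc j) 0
    [1/[1+j]!] = mkℚᵘ (ℤ.+ 1) (ℕ.pred (suc j !))
    [1/j!] = mkℚᵘ (ℤ.+ 1) (ℕ.pred (j !))
    cross : (ℤ.+ suc j ℤ.* ℤ.+ 1) ℤ.* ℤ.+ suc (ℕ.pred (j !)) ≡ ℤ.+ 1 ℤ.* ℤ.+ (1 ℕ.* suc (ℕ.pred (suc j !)))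
    cross = begin
      (ℤ.+ suc j ℤ.* ℤ.+ 1) ℤ.* ℤ.+ suc (ℕ.pred (j !))
        ≡⟨ cong₂ (λ a b → a ℤ.* ℤ.+ b) (ℤP.*-identityʳ (ℤ.+ suc j)) (ℕP.suc-pred (j !) {{j !≢0}}) ⟩
      ℤ.+ suc j ℤ.* ℤ.+ (j !)
        ≡⟨ ℤP.pos-* (suc j) (j !) ⟨
      ℤ.+ (suc j !)
        ≡⟨ cong ℤ.+_ (trans (ℕP.*-identityˡ _) (ℕP.suc-pred (suc j !) {{suc j !≢0}})) ⟨
      ℤ.+ (1 ℕ.* suc (ℕ.pred (suc j !)))
        ≡⟨ ℤP.*-identityˡ _ ⟨
      ℤ.+ 1 ℤ.* ℤ.+ (1 ℕ.* suc (ℕ.pred (suc j !))) ∎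

  n!*invFact[n]≡1 : ∀ n → ℕ→ℚ (n !) * invFact n ≡ 1ℚ
  n!*invFact[n]≡1 zero    = refl
  n!*invFact[n]≡1 (suc n) = begin
    ℕ→ℚ (suc n !) * invFact (suc n)
      ≡⟨ cong (_* invFact (suc n)) (ℕ→ℚ-homo-* (suc n) (n !)) ⟩
    ℕ→ℚ (suc n) * ℕ→ℚ (n !) * invFact (suc n)
      ≡⟨ solve 3 (λ a b c → a :* b :* c := b :* (a :* c)) refl (ℕ→ℚ (suc n)) (ℕ→ℚ (n !)) (invFact (suc n)) ⟩
    ℕ→ℚ (n !) * (ℕ→ℚ (suc n) * invFact (suc n))
      ≡⟨ cong (ℕ→ℚ (n !) *_) ([1+j]*invFact[1+j]≡invFact[j] n) ⟩
    ℕ→ℚ (n !) * invFact n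
      ≡⟨ n!*invFact[n]≡1 n ⟩
    1ℚ ∎
    where open ≡-Reasoning

  suc-*-cancelˡ : ∀ j {x y} → ℕ→ℚ (suc j) * x ≡ ℕ→ℚ (suc j) * y → x ≡ y
  suc-*-cancelˡ j {x} {y} eq = begin
    x                  ≡⟨ ℚP.*-identityˡ x ⟨
    1ℚ * x             ≡⟨ cong (_* x) inverse ⟨
    w * s * x          ≡⟨ ℚP.*-assoc w s x ⟩
    w * (s * x)        ≡⟨ cong (w *_) eq ⟩
    w * (s * y)        ≡⟨ ℚP.*-assoc w s y ⟨
    w * s * y          ≡⟨ cong (_* y) inverse ⟩
    1ℚ * y             ≡⟨ ℚP.*-identityˡ y ⟩
    y                  ∎
    where
    open ≡-Reasoning
    s = ℕ→ℚ (suc j)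
    w = ℕ→ℚ (j !) * invFact (suc j)
    inverse : w * s ≡ 1ℚ
    inverse = begin
      ℕ→ℚ (j !) * invFact (suc j) * s
        ≡⟨ ℚP.*-assoc (ℕ→ℚ (j !)) (invFact (suc j)) s ⟩
      ℕ→ℚ (j !) * (invFact (suc j) * s)
        ≡⟨ cong (ℕ→ℚ (j !) *_) (trans (ℚP.*-comm (invFact (suc j)) s) ([1+j]*invFact[1+j]≡invFact[j] j)) ⟩
      ℕ→ℚ (j !) * invFact j
        ≡⟨ n!*invFact[n]≡1 j ⟩
      1ℚ ∎

  Σ≤-cong : ∀ n {f g : ℕ → ℚ} → (∀ i → i ≤ n → f i ≡ g i) → Σ≤ n f ≡ Σ≤ n g
  Σ≤-cong zero    f≗g = f≗g 0 z≤n
  Σ≤-cong (suc n) f≗g = cong₂ _+_ (Σ≤-cong n (λ i i≤n → f≗g i (ℕP.m≤n⇒m≤1+n i≤n))) (f≗g (suc n) ℕP.≤-refl)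

  Σ≤-distrib-+ : ∀ n (f g : ℕ → ℚ) → Σ≤ n (λ i → f i + g i) ≡ Σ≤ n f + Σ≤ n g
  Σ≤-distrib-+ zero    f g = refl
  Σ≤-distrib-+ (suc n) f g = trans (cong (_+ (f (suc n) + g (suc n))) (Σ≤-distrib-+ n f g))
    (solve 4 (λ a b c d → (a :+ b) :+ (c :+ d) := (a :+ c) :+ (b :+ d))
       refl (Σ≤ n f) (Σ≤ n g) (f (suc n)) (g (suc n)))

  Σ≤-distrib-- : ∀ n (f g : ℕ → ℚ) → Σ≤ n (λ i → f i - g i) ≡ Σ≤ n f - Σ≤ n g
  Σ≤-distrib-- zero    f g = refl
  Σ≤-distrib-- (suc n) f g = trans (cong (_+ (f (suc n) - g (suc n))) (Σ≤-distrib-- n f g))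
    (solve 4 (λ a b c d → (a :- b) :+ (c :- d) := (a :+ c) :- (b :+ d))
       refl (Σ≤ n f) (Σ≤ n g) (f (suc n)) (g (suc n)))

  Σ≤-*ˡ : ∀ n c (f : ℕ → ℚ) → Σ≤ n (λ i → c * f i) ≡ c * Σ≤ n f
  Σ≤-*ˡ zero    c f = refl
  Σ≤-*ˡ (suc n) c f = trans (cong (_+ c * f (suc n)) (Σ≤-*ˡ n c f)) (sym (ℚP.*-distribˡ-+ c (Σ≤ n f) (f (suc n))))

  Σ≤-zero : ∀ n (f : ℕ → ℚ) → (∀ i → i ≤ n → f i ≡ 0ℚ) → Σ≤ n f ≡ 0ℚ
  Σ≤-zero zero    f f≡0 = f≡0 0 z≤n
  Σ≤-zero (suc n) f f≡0 = cong₂ _+_ (Σ≤-zero n f (λ i i≤n → f≡0 i (ℕP.m≤n⇒m≤1+n i≤n))) (f≡0 (suc n) ℕP.≤-refl)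

  Σ≤-head : ∀ n (f : ℕ → ℚ) → Σ≤ (suc n) f ≡ f 0 + Σ≤ n (λ i → f (suc i))
  Σ≤-head zero    f = refl
  Σ≤-head (suc n) f = trans (cong (_+ f (suc (suc n))) (Σ≤-head n f)) (ℚP.+-assoc (f 0) _ _)

  Σ≤-comm : ∀ m n (f : ℕ → ℕ → ℚ) → Σ≤ m (λ i → Σ≤ n (f i)) ≡ Σ≤ n (λ k → Σ≤ m (λ i → f i k))
  Σ≤-comm zero    n f = refl
  Σ≤-comm (suc m) n f = trans (cong (_+ Σ≤ n (f (suc m))) (Σ≤-comm m n f))
    (sym (Σ≤-distrib-+ n (λ k → Σ≤ m (λ i → f i k)) (f (suc m))))

  Σ≤-extend : ∀ {n L} (f : ℕ → ℚ) → n ≤ L → (∀ i → n < i → f i ≡ 0ℚ) → Σ≤ L f ≡ Σ≤ n f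
  Σ≤-extend f n≤L f≡0 with ℕP.m≤n⇒m<n∨m≡n n≤L
  ... | inj₂ refl = refl
  ... | inj₁ (s≤s {n = L} n≤L) =
    trans (cong₂ _+_ (Σ≤-extend f n≤L f≡0) (f≡0 (suc L) (s≤s n≤L))) (ℚP.+-identityʳ _)

  Σ≤-telescope : ∀ n (a : ℕ → ℚ) → Σ≤ n (λ i → a i - a (suc i)) ≡ a 0 - a (suc n)
  Σ≤-telescope zero    a = refl
  Σ≤-telescope (suc n) a = trans (cong (_+ (a (suc n) - a (suc (suc n)))) (Σ≤-telescope n a))
    (solve 3 (λ x y z → (x :- y) :+ (y :- z) := x :- z) refl (a 0) (a (suc n)) (a (suc (suc n))))

  -- Formal power series

  infixl 6 _+ₛ_ _-ₛ_
  infixr 7 _·ₛ_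

  _+ₛ_ _-ₛ_ : Series → Series → Series
  (f +ₛ g) j = f j + g j
  (f -ₛ g) j = f j - g j

  _·ₛ_ : ℚ → Series → Series
  (c ·ₛ f) j = c * f j

  δ : Series
  δ zero    = 1ℚ
  δ (suc _) = 0ℚ

  ^ₛ-zero : ∀ f → f ^ₛ 0 ≗ δ
  ^ₛ-zero f zero    = refl
  ^ₛ-zero f (suc _) = refl

  der : Series → Series
  der f j = ℕ→ℚ (suc j) * f (suc j)

  der-^ₛ-zero : ∀ f j → der (f ^ₛ 0) j ≡ 0ℚ
  der-^ₛ-zero f j = ℚP.*-zeroʳ (ℕ→ℚ (suc j))

  ⊛-cong-≤ : ∀ j {f f′ g g′ : Series} → (∀ i → i ≤ j → f i ≡ f′ i) → (∀ i → i ≤ j → g i ≡ g′ i) →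
             (f ⊛ g) j ≡ (f′ ⊛ g′) j
  ⊛-cong-≤ j f≡f′ g≡g′ = Σ≤-cong j (λ i i≤j → cong₂ _*_ (f≡f′ i i≤j) (g≡g′ (j ℕ.∸ i) (ℕP.m∸n≤m j i)))

  ⊛-congˡ : ∀ {f f′} g → f ≗ f′ → f ⊛ g ≗ f′ ⊛ g
  ⊛-congˡ g f≗f′ j = ⊛-cong-≤ j {g = g} (λ i _ → f≗f′ i) (λ _ _ → refl)

  ⊛-congʳ : ∀ f {g g′} → g ≗ g′ → f ⊛ g ≗ f ⊛ g′
  ⊛-congʳ f g≗g′ j = ⊛-cong-≤ j {f} (λ _ _ → refl) (λ i _ → g≗g′ i)

  ⊛-distribˡ-+ : ∀ f g h → f ⊛ (g +ₛ h) ≗ (f ⊛ g) +ₛ (f ⊛ h)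
  ⊛-distribˡ-+ f g h j = trans (Σ≤-cong j (λ i _ → ℚP.*-distribˡ-+ (f i) (g (j ℕ.∸ i)) (h (j ℕ.∸ i))))
    (Σ≤-distrib-+ j (λ i → f i * g (j ℕ.∸ i)) (λ i → f i * h (j ℕ.∸ i)))

  ⊛-distribʳ-+ : ∀ f g h → (f +ₛ g) ⊛ h ≗ (f ⊛ h) +ₛ (g ⊛ h)
  ⊛-distribʳ-+ f g h j = trans (Σ≤-cong j (λ i _ → ℚP.*-distribʳ-+ (h (j ℕ.∸ i)) (f i) (g i)))
    (Σ≤-distrib-+ j (λ i → f i * h (j ℕ.∸ i)) (λ i → g i * h (j ℕ.∸ i)))

  ⊛-distribˡ-- : ∀ f g h → f ⊛ (g -ₛ h) ≗ (f ⊛ g) -ₛ (f ⊛ h)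
  ⊛-distribˡ-- f g h j = trans (Σ≤-cong j (λ i _ → solve 3 (λ a b c → a :* (b :- c) := a :* b :- a :* c)
                                                     refl (f i) (g (j ℕ.∸ i)) (h (j ℕ.∸ i))))
    (Σ≤-distrib-- j (λ i → f i * g (j ℕ.∸ i)) (λ i → f i * h (j ℕ.∸ i)))

  ⊛-distribʳ-- : ∀ f g h → (f -ₛ g) ⊛ h ≗ (f ⊛ h) -ₛ (g ⊛ h)
  ⊛-distribʳ-- f g h j = trans (Σ≤-cong j (λ i _ → solve 3 (λ a b c → (b :- c) :* a := b :* a :- c :* a)
                                                     refl (h (j ℕ.∸ i)) (f i) (g i)))
    (Σ≤-distrib-- j (λ i → f i * h (j ℕ.∸ i)) (λ i → g i * h (j ℕ.∸ i)))

  ⊛-·ˡ : ∀ c f g → (c ·ₛ f) ⊛ g ≗ c ·ₛ (f ⊛ g)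
  ⊛-·ˡ c f g j = trans (Σ≤-cong j (λ i _ → ℚP.*-assoc c (f i) (g (j ℕ.∸ i)))) (Σ≤-*ˡ j c (λ i → f i * g (j ℕ.∸ i)))

  ⊛-·ʳ : ∀ c f g → f ⊛ (c ·ₛ g) ≗ c ·ₛ (f ⊛ g)
  ⊛-·ʳ c f g j = trans (Σ≤-cong j (λ i _ → solve 3 (λ a b c → a :* (c :* b) := c :* (a :* b))
                                             refl (f i) (g (j ℕ.∸ i)) c))
    (Σ≤-*ˡ j c (λ i → f i * g (j ℕ.∸ i)))

  ⊛-zeroʳ : ∀ f {g} → (∀ i → g i ≡ 0ℚ) → ∀ j → (f ⊛ g) j ≡ 0ℚ
  ⊛-zeroʳ f {g} g≡0 j = Σ≤-zero j _ (λ i _ → trans (cong (f i *_) (g≡0 (j ℕ.∸ i))) (ℚP.*-zeroʳ (f i)))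

  ⊛-identityˡ : ∀ f → δ ⊛ f ≗ f
  ⊛-identityˡ f zero    = ℚP.*-identityˡ (f 0)
  ⊛-identityˡ f (suc j) = begin
    (δ ⊛ f) (suc j)
      ≡⟨ Σ≤-head j (λ i → δ i * f (suc j ℕ.∸ i)) ⟩
    1ℚ * f (suc j) + Σ≤ j (λ i → 0ℚ * f (j ℕ.∸ i))
      ≡⟨ cong₂ _+_ (ℚP.*-identityˡ (f (suc j))) (Σ≤-zero j _ (λ i _ → ℚP.*-zeroˡ (f (j ℕ.∸ i)))) ⟩
    f (suc j) + 0ℚ
      ≡⟨ ℚP.+-identityʳ (f (suc j)) ⟩
    f (suc j) ∎
    where open ≡-Reasoning

  ⊛-identityʳ : ∀ f → f ⊛ δ ≗ f
  ⊛-identityʳ f zero    = ℚP.*-identityʳ (f 0)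
  ⊛-identityʳ f (suc j) = begin
    Σ≤ j (λ i → f i * δ (suc j ℕ.∸ i)) + f (suc j) * δ (suc j ℕ.∸ suc j)
      ≡⟨ cong₂ _+_ (Σ≤-zero j _ (λ i i≤j → trans (cong (λ m → f i * δ m) (ℕP.+-∸-assoc 1 i≤j)) (ℚP.*-zeroʳ (f i))))
                   (cong (λ m → f (suc j) * δ m) (ℕP.n∸n≡0 j)) ⟩
    0ℚ + f (suc j) * 1ℚ
      ≡⟨ trans (ℚP.+-identityˡ _) (ℚP.*-identityʳ (f (suc j))) ⟩
    f (suc j) ∎
    where open ≡-Reasoning

  ⊛-order : ∀ {f g n} → f 0 ≡ 0ℚ → (∀ i → i < n → g i ≡ 0ℚ) → ∀ j → j ≤ n → (f ⊛ g) j ≡ 0ℚ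
  ⊛-order {f} {g} f0≡0 g≡0 zero    _ = trans (cong (_* g 0) f0≡0) (ℚP.*-zeroˡ (g 0))
  ⊛-order {f} {g} f0≡0 g≡0 (suc j) j<n = begin
    (f ⊛ g) (suc j)
      ≡⟨ Σ≤-head j (λ i → f i * g (suc j ℕ.∸ i)) ⟩
    f 0 * g (suc j) + Σ≤ j (λ i → f (suc i) * g (j ℕ.∸ i))
      ≡⟨ cong₂ _+_ (trans (cong (_* g (suc j)) f0≡0) (ℚP.*-zeroˡ (g (suc j)))) (Σ≤-zero j _ high-vanish) ⟩
    0ℚ + 0ℚ
      ≡⟨⟩
    0ℚ ∎
    where
    open ≡-Reasoning
    high-vanish : ∀ i → i ≤ j → f (suc i) * g (j ℕ.∸ i) ≡ 0ℚ
    high-vanish i _ = trans (cong (f (suc i) *_) (g≡0 (j ℕ.∸ i) (ℕP.≤-<-trans (ℕP.m∸n≤m j i) j<n)))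
                            (ℚP.*-zeroʳ (f (suc i)))

  ^ₛ-order : ∀ {f} → f 0 ≡ 0ℚ → ∀ n j → j < n → (f ^ₛ n) j ≡ 0ℚ
  ^ₛ-order {f} f0≡0 (suc n) j (s≤s j≤n) = ⊛-order {f} {f ^ₛ n} f0≡0 (^ₛ-order f0≡0 n) j j≤n

  ⊛-Σ≤ : ∀ L f (F : ℕ → Series) → f ⊛ (λ i → Σ≤ L (λ n → F n i)) ≗ λ j → Σ≤ L (λ n → (f ⊛ F n) j)
  ⊛-Σ≤ L f F j = begin
    Σ≤ j (λ i → f i * Σ≤ L (λ n → F n (j ℕ.∸ i)))
      ≡⟨ Σ≤-cong j (λ i _ → Σ≤-*ˡ L (f i) (λ n → F n (j ℕ.∸ i))) ⟨
    Σ≤ j (λ i → Σ≤ L (λ n → f i * F n (j ℕ.∸ i)))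
      ≡⟨ Σ≤-comm j L (λ i n → f i * F n (j ℕ.∸ i)) ⟩
    Σ≤ L (λ n → (f ⊛ F n) j) ∎
    where open ≡-Reasoning

  der-cong : ∀ {f g} → f ≗ g → der f ≗ der g
  der-cong f≗g j = cong (ℕ→ℚ (suc j) *_) (f≗g (suc j))

  der-⊛ : ∀ f g → der (f ⊛ g) ≗ (der f ⊛ g) +ₛ (f ⊛ der g)
  der-⊛ f g j = begin
    ℕ→ℚ (suc j) * Σ≤ (suc j) (λ i → f i * g (suc j ℕ.∸ i))    ≡⟨ Σ≤-*ˡ (suc j) (ℕ→ℚ (suc j)) _ ⟨
    Σ≤ (suc j) (λ i → ℕ→ℚ (suc j) * (f i * g (suc j ℕ.∸ i))) ≡⟨ Σ≤-cong (suc j) split ⟩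
    Σ≤ (suc j) (λ i → L i + R i)                             ≡⟨ Σ≤-distrib-+ (suc j) L R ⟩
    Σ≤ (suc j) L + Σ≤ (suc j) R                              ≡⟨ cong₂ _+_ ΣL ΣR ⟩
    (der f ⊛ g) j + (f ⊛ der g) j                            ∎
    where
    open ≡-Reasoning
    L R : ℕ → ℚ
    L i = ℕ→ℚ i * f i * g (suc j ℕ.∸ i)
    R i = f i * (ℕ→ℚ (suc j ℕ.∸ i) * g (suc j ℕ.∸ i))
    split : ∀ i → i ≤ suc j → ℕ→ℚ (suc j) * (f i * g (suc j ℕ.∸ i)) ≡ L i + R i
    split i i≤1+j = begin
      ℕ→ℚ (suc j) * (f i * g (suc j ℕ.∸ i))
        ≡⟨ cong (λ m → ℕ→ℚ m * (f i * g (suc j ℕ.∸ i))) (ℕP.m+[n∸m]≡n i≤1+j) ⟨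
      ℕ→ℚ (i ℕ.+ (suc j ℕ.∸ i)) * (f i * g (suc j ℕ.∸ i))
        ≡⟨ cong (_* (f i * g (suc j ℕ.∸ i))) (ℕ→ℚ-homo-+ i (suc j ℕ.∸ i)) ⟩
      (ℕ→ℚ i + ℕ→ℚ (suc j ℕ.∸ i)) * (f i * g (suc j ℕ.∸ i))
        ≡⟨ solve 4 (λ a b c d → (a :+ b) :* (c :* d) := a :* c :* d :+ c :* (b :* d))
             refl (ℕ→ℚ i) (ℕ→ℚ (suc j ℕ.∸ i)) (f i) (g (suc j ℕ.∸ i)) ⟩
      L i + R i ∎
    ΣL : Σ≤ (suc j) L ≡ (der f ⊛ g) j
    ΣL = begin
      Σ≤ (suc j) L
        ≡⟨ Σ≤-head j L ⟩
      0ℚ * f 0 * g (suc j) + Σ≤ j (L ∘ suc)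
        ≡⟨ cong (_+ Σ≤ j (L ∘ suc)) (trans (cong (_* g (suc j)) (ℚP.*-zeroˡ (f 0))) (ℚP.*-zeroˡ (g (suc j)))) ⟩
      0ℚ + Σ≤ j (L ∘ suc)
        ≡⟨ ℚP.+-identityˡ _ ⟩
      (der f ⊛ g) j ∎
    ΣR : Σ≤ (suc j) R ≡ (f ⊛ der g) j
    ΣR = begin
      Σ≤ j R + f (suc j) * (ℕ→ℚ (suc j ℕ.∸ suc j) * g (suc j ℕ.∸ suc j))
        ≡⟨ cong (λ m → Σ≤ j R + f (suc j) * (ℕ→ℚ m * g m)) (ℕP.n∸n≡0 j) ⟩
      Σ≤ j R + f (suc j) * (0ℚ * g 0)
        ≡⟨ cong (λ x → Σ≤ j R + f (suc j) * x) (ℚP.*-zeroˡ (g 0)) ⟩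
      Σ≤ j R + f (suc j) * 0ℚ
        ≡⟨ trans (cong (λ x → Σ≤ j R + x) (ℚP.*-zeroʳ (f (suc j)))) (ℚP.+-identityʳ _) ⟩
      Σ≤ j R
        ≡⟨ Σ≤-cong j (λ i i≤j → cong (λ m → f i * (ℕ→ℚ m * g m)) (ℕP.+-∸-assoc 1 i≤j)) ⟩
      (f ⊛ der g) j ∎

  ≗-by-der : ∀ {f g} → f 0 ≡ g 0 → (∀ j → (∀ i → i ≤ j → f i ≡ g i) → der f j ≡ der g j) → f ≗ g
  ≗-by-der {f} {g} f0≡g0 der≡ j = agree-≤ j j ℕP.≤-refl
    where
    agree-≤ : ∀ n i → i ≤ n → f i ≡ g i
    agree-≤ zero    .zero z≤n = f0≡g0
    agree-≤ (suc n) i i≤1+n with ℕP.m≤n⇒m<n∨m≡n i≤1+n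
    ... | inj₁ (s≤s i≤n) = agree-≤ n i i≤n
    ... | inj₂ refl      = suc-*-cancelˡ n (der≡ n (agree-≤ n))

  -- Via the Leibniz rule and induction on the degree, avoiding a reindexed double sum.
  ⊛-assoc : ∀ f g h → (f ⊛ g) ⊛ h ≗ f ⊛ (g ⊛ h)
  ⊛-assoc f g h zero    = ℚP.*-assoc (f 0) (g 0) (h 0)
  ⊛-assoc f g h (suc j) = suc-*-cancelˡ j (begin
    der ((f ⊛ g) ⊛ h) j
      ≡⟨ der-⊛ (f ⊛ g) h j ⟩
    (der (f ⊛ g) ⊛ h) j + ((f ⊛ g) ⊛ der h) j
      ≡⟨ cong (_+ ((f ⊛ g) ⊛ der h) j) (trans (⊛-congˡ h (der-⊛ f g) j) (⊛-distribʳ-+ (der f ⊛ g) (f ⊛ der g) h j)) ⟩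
    ((der f ⊛ g) ⊛ h) j + ((f ⊛ der g) ⊛ h) j + ((f ⊛ g) ⊛ der h) j
      ≡⟨ cong₂ _+_ (cong₂ _+_ (⊛-assoc (der f) g h j) (⊛-assoc f (der g) h j)) (⊛-assoc f g (der h) j) ⟩
    (der f ⊛ (g ⊛ h)) j + (f ⊛ (der g ⊛ h)) j + (f ⊛ (g ⊛ der h)) j
      ≡⟨ ℚP.+-assoc ((der f ⊛ (g ⊛ h)) j) ((f ⊛ (der g ⊛ h)) j) ((f ⊛ (g ⊛ der h)) j) ⟩
    (der f ⊛ (g ⊛ h)) j + ((f ⊛ (der g ⊛ h)) j + (f ⊛ (g ⊛ der h)) j)
      ≡⟨ cong ((der f ⊛ (g ⊛ h)) j +_) (trans (⊛-congʳ f (der-⊛ g h) j) (⊛-distribˡ-+ f (der g ⊛ h) (g ⊛ der h) j)) ⟨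
    (der f ⊛ (g ⊛ h)) j + (f ⊛ der (g ⊛ h)) j
      ≡⟨ der-⊛ f (g ⊛ h) j ⟨
    der (f ⊛ (g ⊛ h)) j ∎)
    where open ≡-Reasoning

  expₛ : ℚ → Series
  expₛ c j = c ^ j * invFact j

  der-expₛ : ∀ c → der (expₛ c) ≗ c ·ₛ expₛ c
  der-expₛ c j = begin
    ℕ→ℚ (suc j) * (c * c ^ j * invFact (suc j))
      ≡⟨ solve 4 (λ n c p i → n :* (c :* p :* i) := c :* (p :* (n :* i)))
           refl (ℕ→ℚ (suc j)) c (c ^ j) (invFact (suc j)) ⟩
    c * (c ^ j * (ℕ→ℚ (suc j) * invFact (suc j)))
      ≡⟨ cong (λ x → c * (c ^ j * x)) ([1+j]*invFact[1+j]≡invFact[j] j) ⟩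
    c * expₛ c j ∎
    where open ≡-Reasoning

  expₛ-+ : ∀ a b → expₛ a ⊛ expₛ b ≗ expₛ (a + b)
  expₛ-+ a b = ≗-by-der refl der≡
    where
    open ≡-Reasoning
    der≡ : ∀ j → (∀ i → i ≤ j → (expₛ a ⊛ expₛ b) i ≡ expₛ (a + b) i) → der (expₛ a ⊛ expₛ b) j ≡ der (expₛ (a + b)) j
    der≡ j ih = begin
      der (expₛ a ⊛ expₛ b) j                            ≡⟨ der-⊛ (expₛ a) (expₛ b) j ⟩
      (der (expₛ a) ⊛ expₛ b) j + (expₛ a ⊛ der (expₛ b)) j
        ≡⟨ cong₂ _+_ (trans (⊛-congˡ (expₛ b) (der-expₛ a) j) (⊛-·ˡ a (expₛ a) (expₛ b) j))
                     (trans (⊛-congʳ (expₛ a) (der-expₛ b) j) (⊛-·ʳ b (expₛ a) (expₛ b) j)) ⟩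
      a * (expₛ a ⊛ expₛ b) j + b * (expₛ a ⊛ expₛ b) j  ≡⟨ ℚP.*-distribʳ-+ ((expₛ a ⊛ expₛ b) j) a b ⟨
      (a + b) * (expₛ a ⊛ expₛ b) j                      ≡⟨ cong ((a + b) *_) (ih j ℕP.≤-refl) ⟩
      (a + b) * expₛ (a + b) j                           ≡⟨ der-expₛ (a + b) j ⟨
      der (expₛ (a + b)) j                               ∎

  expₛ-0 : expₛ 0ℚ ≗ δ
  expₛ-0 zero    = refl
  expₛ-0 (suc j) = trans (cong (_* invFact (suc j)) (ℚP.*-zeroˡ (0ℚ ^ j))) (ℚP.*-zeroˡ (invFact (suc j)))

  expNeg≗expₛ[-1] : expNeg ≗ expₛ (- 1ℚ)
  expNeg≗expₛ[-1] j = cong (_* invFact j) (sgn≡[-1]^ j)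
    where
    sgn≡[-1]^ : ∀ j → sgn j ≡ (- 1ℚ) ^ j
    sgn≡[-1]^ zero    = refl
    sgn≡[-1]^ (suc j) = trans (cong -_ (sgn≡[-1]^ j)) (solve 1 (λ x → :- x := (:- con 1ℚ) :* x) refl ((- 1ℚ) ^ j))

  expMinusOne : Series
  expMinusOne = expₛ 1ℚ -ₛ δ

  expMinusOne-suc : ∀ j → expMinusOne (suc j) ≡ E j
  expMinusOne-suc j = begin
    1ℚ ^ suc j * invFact (suc j) - 0ℚ  ≡⟨ cong (λ x → x * invFact (suc j) - 0ℚ) (1^n≡1 (suc j)) ⟩
    1ℚ * invFact (suc j) - 0ℚ          ≡⟨ solve 1 (λ x → con 1ℚ :* x :- con 0ℚ := x) refl (invFact (suc j)) ⟩
    E j                                ∎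
    where
    open ≡-Reasoning
    1^n≡1 : ∀ n → 1ℚ ^ n ≡ 1ℚ
    1^n≡1 zero    = refl
    1^n≡1 (suc n) = trans (ℚP.*-identityˡ (1ℚ ^ n)) (1^n≡1 n)

  -- Powers of u = 1 − e^{−t} and the operator θ = (e^t − 1)·d/dt

  u : Series
  u = oneMinusExpNeg

  u≗δ-expNeg : u ≗ δ -ₛ expNeg
  u≗δ-expNeg zero    = refl
  u≗δ-expNeg (suc j) = sym (ℚP.+-identityˡ (- expNeg (suc j)))

  der-u : der u ≗ expNeg
  der-u j = begin
    ℕ→ℚ (suc j) * (- (- sgn j * invFact (suc j)))
      ≡⟨ solve 3 (λ n s i → n :* (:- ((:- s) :* i)) := s :* (n :* i)) refl (ℕ→ℚ (suc j)) (sgn j) (invFact (suc j)) ⟩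
    sgn j * (ℕ→ℚ (suc j) * invFact (suc j))
      ≡⟨ cong (sgn j *_) ([1+j]*invFact[1+j]≡invFact[j] j) ⟩
    expNeg j ∎
    where open ≡-Reasoning

  expₛ1-⊛-expNeg : expₛ 1ℚ ⊛ expNeg ≗ δ
  expₛ1-⊛-expNeg j = trans (⊛-congʳ (expₛ 1ℚ) expNeg≗expₛ[-1] j) (trans (expₛ-+ 1ℚ (- 1ℚ) j) (expₛ-0 j))

  expMinusOne-⊛-expNeg : expMinusOne ⊛ expNeg ≗ u
  expMinusOne-⊛-expNeg j = begin
    (expMinusOne ⊛ expNeg) j                ≡⟨ ⊛-distribʳ-- (expₛ 1ℚ) δ expNeg j ⟩
    (expₛ 1ℚ ⊛ expNeg) j - (δ ⊛ expNeg) j   ≡⟨ cong₂ _-_ (expₛ1-⊛-expNeg j) (⊛-identityˡ expNeg j) ⟩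
    δ j - expNeg j                          ≡⟨ u≗δ-expNeg j ⟨
    u j                                     ∎
    where open ≡-Reasoning

  expNeg≗δ-u : expNeg ≗ δ -ₛ u
  expNeg≗δ-u j = trans (solve 2 (λ d e → e := d :- (d :- e))
                          refl (δ j) (expNeg j)) (cong (λ x → δ j - x) (sym (u≗δ-expNeg j)))

  expNeg-⊛-u^ : ∀ n → expNeg ⊛ (u ^ₛ n) ≗ (u ^ₛ n) -ₛ (u ^ₛ suc n)
  expNeg-⊛-u^ n j = begin
    (expNeg ⊛ (u ^ₛ n)) j                    ≡⟨ ⊛-congˡ (u ^ₛ n) expNeg≗δ-u j ⟩
    ((δ -ₛ u) ⊛ (u ^ₛ n)) j                  ≡⟨ ⊛-distribʳ-- δ u (u ^ₛ n) j ⟩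
    (δ ⊛ (u ^ₛ n)) j - (u ^ₛ suc n) j        ≡⟨ cong (_- (u ^ₛ suc n) j) (⊛-identityˡ (u ^ₛ n) j) ⟩
    (u ^ₛ n) j - (u ^ₛ suc n) j              ∎
    where open ≡-Reasoning

  der-u^ : ∀ n → der (u ^ₛ suc n) ≗ ℕ→ℚ (suc n) ·ₛ ((u ^ₛ n) -ₛ (u ^ₛ suc n))
  der-u^ zero j = begin
    der (u ⊛ (u ^ₛ 0)) j
      ≡⟨ der-⊛ u (u ^ₛ 0) j ⟩
    (der u ⊛ (u ^ₛ 0)) j + (u ⊛ der (u ^ₛ 0)) j
      ≡⟨ cong₂ _+_ (trans (⊛-congˡ (u ^ₛ 0) der-u j) (expNeg-⊛-u^ 0 j))
                                                               (⊛-zeroʳ u (der-^ₛ-zero u) j) ⟩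
    (u ^ₛ 0) j - (u ^ₛ 1) j + 0ℚ
      ≡⟨ trans (ℚP.+-identityʳ ((u ^ₛ 0) j - (u ^ₛ 1) j)) (sym (ℚP.*-identityˡ ((u ^ₛ 0) j - (u ^ₛ 1) j))) ⟩
    1ℚ * ((u ^ₛ 0) j - (u ^ₛ 1) j) ∎
    where open ≡-Reasoning
  der-u^ (suc n) j = begin
    der (u ⊛ (u ^ₛ suc n)) j
      ≡⟨ der-⊛ u (u ^ₛ suc n) j ⟩
    (der u ⊛ (u ^ₛ suc n)) j + (u ⊛ der (u ^ₛ suc n)) j
      ≡⟨ cong₂ _+_ (trans (⊛-congˡ (u ^ₛ suc n) der-u j) (expNeg-⊛-u^ (suc n) j)) u-⊛-der ⟩
    X + c * X
      ≡⟨ solve 2 (λ x c → x :+ c :* x := (con 1ℚ :+ c) :* x) refl X c ⟩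
    (1ℚ + c) * X
      ≡⟨ cong (_* X) (ℕ→ℚ-homo-+ 1 (suc n)) ⟨
    ℕ→ℚ (suc (suc n)) * X ∎
    where
    open ≡-Reasoning
    c = ℕ→ℚ (suc n)
    X = (u ^ₛ suc n) j - (u ^ₛ suc (suc n)) j
    u-⊛-der : (u ⊛ der (u ^ₛ suc n)) j ≡ c * X
    u-⊛-der = begin
      (u ⊛ der (u ^ₛ suc n)) j
        ≡⟨ ⊛-congʳ u (der-u^ n) j ⟩
      (u ⊛ (c ·ₛ ((u ^ₛ n) -ₛ (u ^ₛ suc n)))) j
        ≡⟨ ⊛-·ʳ c u ((u ^ₛ n) -ₛ (u ^ₛ suc n)) j ⟩
      c * (u ⊛ ((u ^ₛ n) -ₛ (u ^ₛ suc n))) j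
        ≡⟨ cong (c *_) (⊛-distribˡ-- u (u ^ₛ n) (u ^ₛ suc n) j) ⟩
      c * X ∎

  θ : Series → Series
  θ f = expMinusOne ⊛ der f

  θ-u^ : ∀ n → θ (u ^ₛ n) ≗ ℕ→ℚ n ·ₛ (u ^ₛ n)
  θ-u^ zero    j = trans (⊛-zeroʳ expMinusOne (der-^ₛ-zero u) j) (sym (ℚP.*-zeroˡ ((u ^ₛ 0) j)))
  θ-u^ (suc n) j = begin
    (expMinusOne ⊛ der (u ^ₛ suc n)) j
      ≡⟨ ⊛-congʳ expMinusOne (der-u^ n) j ⟩
    (expMinusOne ⊛ (c ·ₛ ((u ^ₛ n) -ₛ (u ^ₛ suc n)))) j
      ≡⟨ ⊛-·ʳ c expMinusOne ((u ^ₛ n) -ₛ (u ^ₛ suc n)) j ⟩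
    c * (expMinusOne ⊛ ((u ^ₛ n) -ₛ (u ^ₛ suc n))) j
      ≡⟨ cong (c *_) (⊛-congʳ expMinusOne (expNeg-⊛-u^ n) j) ⟨
    c * (expMinusOne ⊛ (expNeg ⊛ (u ^ₛ n))) j
      ≡⟨ cong (c *_) (⊛-assoc expMinusOne expNeg (u ^ₛ n) j) ⟨
    c * ((expMinusOne ⊛ expNeg) ⊛ (u ^ₛ n)) j
      ≡⟨ cong (c *_) (⊛-congˡ (u ^ₛ n) expMinusOne-⊛-expNeg j) ⟩
    c * (u ^ₛ suc n) j ∎
    where
    open ≡-Reasoning
    c = ℕ→ℚ (suc n)

  -- Σₙ w n · uⁿ; the coefficient of t^j stops at n = j because uⁿ has order n.
  composeU : (ℕ → ℚ) → Series
  composeU w j = Σ≤ j (λ n → w n * (u ^ₛ n) j)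

  composeU-cong : ∀ {w w′} → w ≗ w′ → composeU w ≗ composeU w′
  composeU-cong w≗w′ j = Σ≤-cong j (λ n _ → cong (_* (u ^ₛ n) j) (w≗w′ n))

  composeU-extend : ∀ w {j L} → j ≤ L → Σ≤ L (λ n → w n * (u ^ₛ n) j) ≡ composeU w j
  composeU-extend w {j} j≤L = Σ≤-extend _ j≤L
    (λ n j<n → trans (cong (w n *_) (^ₛ-order refl n j j<n)) (ℚP.*-zeroʳ (w n)))

  ⊛-composeU : ∀ f w → f ⊛ composeU w ≗ λ j → Σ≤ j (λ n → w n * (f ⊛ (u ^ₛ n)) j)
  ⊛-composeU f w j = begin
    (f ⊛ composeU w) j
      ≡⟨ ⊛-cong-≤ j {f} (λ _ _ → refl) (λ i i≤j → sym (composeU-extend w i≤j)) ⟩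
    (f ⊛ (λ i → Σ≤ j (λ n → w n * (u ^ₛ n) i))) j
      ≡⟨ ⊛-Σ≤ j f (λ n → w n ·ₛ (u ^ₛ n)) j ⟩
    Σ≤ j (λ n → (f ⊛ (w n ·ₛ (u ^ₛ n))) j)
      ≡⟨ Σ≤-cong j (λ n _ → ⊛-·ʳ (w n) f (u ^ₛ n) j) ⟩
    Σ≤ j (λ n → w n * (f ⊛ (u ^ₛ n)) j) ∎
    where open ≡-Reasoning

  der-composeU : ∀ w {j L} → j < L → der (composeU w) j ≡ Σ≤ L (λ n → w n * der (u ^ₛ n) j)
  der-composeU w {j} {L} j<L = begin
    ℕ→ℚ (suc j) * composeU w (suc j)
      ≡⟨ cong (ℕ→ℚ (suc j) *_) (composeU-extend w j<L) ⟨
    ℕ→ℚ (suc j) * Σ≤ L (λ n → w n * (u ^ₛ n) (suc j))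
      ≡⟨ Σ≤-*ˡ L (ℕ→ℚ (suc j)) _ ⟨
    Σ≤ L (λ n → ℕ→ℚ (suc j) * (w n * (u ^ₛ n) (suc j)))
      ≡⟨ Σ≤-cong L (λ n _ → solve 3 (λ c w x → c :* (w :* x) := w :* (c :* x))
                              refl (ℕ→ℚ (suc j)) (w n) ((u ^ₛ n) (suc j))) ⟩
    Σ≤ L (λ n → w n * der (u ^ₛ n) j) ∎
    where open ≡-Reasoning

  θ-composeU : ∀ w → θ (composeU w) ≗ composeU (λ n → ℕ→ℚ n * w n)
  θ-composeU w j = begin
    (expMinusOne ⊛ der (composeU w)) j
      ≡⟨ ⊛-cong-≤ j {expMinusOne} (λ _ _ → refl) (λ i i≤j → der-composeU w (s≤s i≤j)) ⟩
    (expMinusOne ⊛ (λ i → Σ≤ (suc j) (λ n → w n * der (u ^ₛ n) i))) j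
      ≡⟨ ⊛-Σ≤ (suc j) expMinusOne (λ n → w n ·ₛ der (u ^ₛ n)) j ⟩
    Σ≤ (suc j) (λ n → (expMinusOne ⊛ (w n ·ₛ der (u ^ₛ n))) j)
      ≡⟨ Σ≤-cong (suc j) (λ n _ → trans (⊛-·ʳ (w n) expMinusOne (der (u ^ₛ n)) j) (cong (w n *_) (θ-u^ n j))) ⟩
    Σ≤ (suc j) (λ n → w n * (ℕ→ℚ n * (u ^ₛ n) j))
      ≡⟨ Σ≤-cong (suc j) (λ n _ → sym (ℚP.*-assoc (w n) (ℕ→ℚ n) ((u ^ₛ n) j))) ⟩
    Σ≤ (suc j) (λ n → w n * ℕ→ℚ n * (u ^ₛ n) j)
      ≡⟨ Σ≤-cong (suc j) (λ n _ → cong (_* (u ^ₛ n) j) (ℚP.*-comm (w n) (ℕ→ℚ n))) ⟩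
    Σ≤ (suc j) (λ n → ℕ→ℚ n * w n * (u ^ₛ n) j)
      ≡⟨ composeU-extend (λ n → ℕ→ℚ n * w n) (ℕP.n≤1+n j) ⟩
    composeU (λ n → ℕ→ℚ n * w n) j ∎
    where open ≡-Reasoning

  -- The n = 0 term is excluded by hand: ℕ→ℚ (0 ^ 0) would be 1.
  liWeight : ℕ → ℕ → ℚ
  liWeight k zero    = 0ℚ
  liWeight k (suc n) = ℕ→ℚ (suc n ℕ.^ k)

  LiNegComp≗composeU : ∀ k → LiNegComp k ≗ composeU (liWeight k)
  LiNegComp≗composeU k j = Σ≤-cong j term≡
    where
    term≡ : ∀ n → n ≤ j → _ ≡ liWeight k n * (u ^ₛ n) j
    term≡ zero    _ = sym (ℚP.*-zeroˡ ((u ^ₛ 0) j))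
    term≡ (suc n) _ = refl

  LiNegComp-suc : ∀ k → LiNegComp (suc k) ≗ θ (LiNegComp k)
  LiNegComp-suc k j = begin
    LiNegComp (suc k) j
      ≡⟨ LiNegComp≗composeU (suc k) j ⟩
    composeU (liWeight (suc k)) j
      ≡⟨ composeU-cong weight≡ j ⟩
    composeU (λ n → ℕ→ℚ n * liWeight k n) j
      ≡⟨ θ-composeU (liWeight k) j ⟨
    (expMinusOne ⊛ der (composeU (liWeight k))) j
      ≡⟨ ⊛-congʳ expMinusOne (der-cong (LiNegComp≗composeU k)) j ⟨
    (expMinusOne ⊛ der (LiNegComp k)) j ∎
    where
    open ≡-Reasoning
    weight≡ : liWeight (suc k) ≗ λ n → ℕ→ℚ n * liWeight k n
    weight≡ zero    = refl
    weight≡ (suc n) = ℕ→ℚ-homo-* (suc n) (suc n ℕ.^ k)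

  expNeg-⊛-LiNegComp0 : expNeg ⊛ LiNegComp 0 ≗ u
  expNeg-⊛-LiNegComp0 j = begin
    (expNeg ⊛ LiNegComp 0) j
      ≡⟨ ⊛-congʳ expNeg (LiNegComp≗composeU 0) j ⟩
    (expNeg ⊛ composeU (liWeight 0)) j
      ≡⟨ ⊛-composeU expNeg (liWeight 0) j ⟩
    Σ≤ j (λ n → liWeight 0 n * (expNeg ⊛ (u ^ₛ n)) j)
      ≡⟨ Σ≤-cong j (λ n _ → cong (liWeight 0 n *_) (expNeg-⊛-u^ n j)) ⟩
    Σ≤ j (λ n → liWeight 0 n * ((u ^ₛ n) j - (u ^ₛ suc n) j))
      ≡⟨ telescope j ⟩
    u j ∎
    where
    open ≡-Reasoning
    telescope : ∀ j → Σ≤ j (λ n → liWeight 0 n * ((u ^ₛ n) j - (u ^ₛ suc n) j)) ≡ u j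
    telescope zero    = ℚP.*-zeroˡ ((u ^ₛ 0) 0 - (u ^ₛ 1) 0)
    telescope (suc j) = begin
      Σ≤ (suc j) (λ n → liWeight 0 n * ((u ^ₛ n) (suc j) - (u ^ₛ suc n) (suc j)))
        ≡⟨ Σ≤-head j (λ n → liWeight 0 n * ((u ^ₛ n) (suc j) - (u ^ₛ suc n) (suc j))) ⟩
      0ℚ * ((u ^ₛ 0) (suc j) - a 0) + Σ≤ j (λ n → 1ℚ * (a n - a (suc n)))
        ≡⟨ cong₂ _+_ (ℚP.*-zeroˡ ((u ^ₛ 0) (suc j) - a 0)) (Σ≤-cong j (λ n _ → ℚP.*-identityˡ (a n - a (suc n)))) ⟩
      0ℚ + Σ≤ j (λ n → a n - a (suc n))
        ≡⟨ trans (ℚP.+-identityˡ _) (Σ≤-telescope j a) ⟩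
      (u ⊛ (u ^ₛ 0)) (suc j) - a (suc j)
        ≡⟨ cong₂ _-_ (trans (⊛-congʳ u (^ₛ-zero u) (suc j)) (⊛-identityʳ u (suc j)))
                     (^ₛ-order {u} refl (suc (suc j)) (suc j) ℕP.≤-refl) ⟩
      u (suc j) - 0ℚ
        ≡⟨ ℚP.+-identityʳ (u (suc j)) ⟩
      u (suc j) ∎
      where
      a : ℕ → ℚ
      a n = (u ^ₛ suc n) (suc j)

  LiNegComp-zero : LiNegComp 0 ≗ expMinusOne
  LiNegComp-zero j = begin
    LiNegComp 0 j
      ≡⟨ ⊛-identityˡ (LiNegComp 0) j ⟨
    (δ ⊛ LiNegComp 0) j
      ≡⟨ ⊛-congˡ (LiNegComp 0) expₛ1-⊛-expNeg j ⟨
    ((expₛ 1ℚ ⊛ expNeg) ⊛ LiNegComp 0) j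
      ≡⟨ ⊛-assoc (expₛ 1ℚ) expNeg (LiNegComp 0) j ⟩
    (expₛ 1ℚ ⊛ (expNeg ⊛ LiNegComp 0)) j
      ≡⟨ ⊛-congʳ (expₛ 1ℚ) (λ i → trans (expNeg-⊛-LiNegComp0 i) (u≗δ-expNeg i)) j ⟩
    (expₛ 1ℚ ⊛ (δ -ₛ expNeg)) j
      ≡⟨ ⊛-distribˡ-- (expₛ 1ℚ) δ expNeg j ⟩
    (expₛ 1ℚ ⊛ δ) j - (expₛ 1ℚ ⊛ expNeg) j
      ≡⟨ cong₂ _-_ (⊛-identityʳ (expₛ 1ℚ) j) (expₛ1-⊛-expNeg j) ⟩
    expMinusOne j ∎
    where open ≡-Reasoning

  -- Exponential polynomials

  ⟦_⟧ : ExpPoly → Series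
  ⟦ []          ⟧ j = 0ℚ
  ⟦ (c , a) ∷ P ⟧ j = ℤ→ℚ c * expₛ (ℕ→ℚ a) j + ⟦ P ⟧ j

  mulExpMinusOne : ExpPoly → ExpPoly
  mulExpMinusOne []            = []
  mulExpMinusOne ((c , a) ∷ P) = (c , suc a) ∷ (ℤ.- c , a) ∷ mulExpMinusOne P

  derExpPoly : ExpPoly → ExpPoly
  derExpPoly []            = []
  derExpPoly ((c , a) ∷ P) = (c ℤ.* ℤ.+ a , a) ∷ derExpPoly P

  ⟦mulExpMinusOne⟧ : ∀ P → expMinusOne ⊛ ⟦ P ⟧ ≗ ⟦ mulExpMinusOne P ⟧
  ⟦mulExpMinusOne⟧ []            j = ⊛-zeroʳ expMinusOne {⟦ [] ⟧} (λ _ → refl) j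
  ⟦mulExpMinusOne⟧ ((c , a) ∷ P) j = begin
    (expMinusOne ⊛ (ℤ→ℚ c ·ₛ expₛ (ℕ→ℚ a) +ₛ ⟦ P ⟧)) j
      ≡⟨ ⊛-distribˡ-+ expMinusOne (ℤ→ℚ c ·ₛ expₛ (ℕ→ℚ a)) ⟦ P ⟧ j ⟩
    (expMinusOne ⊛ (ℤ→ℚ c ·ₛ expₛ (ℕ→ℚ a))) j + (expMinusOne ⊛ ⟦ P ⟧) j
      ≡⟨ cong₂ _+_ (trans (⊛-·ʳ (ℤ→ℚ c) expMinusOne (expₛ (ℕ→ℚ a)) j) (cong (ℤ→ℚ c *_) shift))
                   (⟦mulExpMinusOne⟧ P j) ⟩
    ℤ→ℚ c * (X - Y) + ⟦ mulExpMinusOne P ⟧ j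
      ≡⟨ solve 4 (λ c x y e → c :* (x :- y) :+ e := c :* x :+ ((:- c) :* y :+ e))
           refl (ℤ→ℚ c) X Y (⟦ mulExpMinusOne P ⟧ j) ⟩
    ℤ→ℚ c * X + (- ℤ→ℚ c * Y + ⟦ mulExpMinusOne P ⟧ j)
      ≡⟨ cong (λ z → ℤ→ℚ c * X + (z * Y + ⟦ mulExpMinusOne P ⟧ j)) (fromℚᵘ-homo‿- (mkℚᵘ c 0)) ⟨
    ⟦ mulExpMinusOne ((c , a) ∷ P) ⟧ j ∎
    where
    open ≡-Reasoning
    X = expₛ (ℕ→ℚ (suc a)) j
    Y = expₛ (ℕ→ℚ a) j
    shift : (expMinusOne ⊛ expₛ (ℕ→ℚ a)) j ≡ X - Y
    shift = begin
      (expMinusOne ⊛ expₛ (ℕ→ℚ a)) j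
        ≡⟨ ⊛-distribʳ-- (expₛ 1ℚ) δ (expₛ (ℕ→ℚ a)) j ⟩
      (expₛ 1ℚ ⊛ expₛ (ℕ→ℚ a)) j - (δ ⊛ expₛ (ℕ→ℚ a)) j
        ≡⟨ cong₂ _-_ (expₛ-+ 1ℚ (ℕ→ℚ a) j) (⊛-identityˡ (expₛ (ℕ→ℚ a)) j) ⟩
      expₛ (1ℚ + ℕ→ℚ a) j - Y
        ≡⟨ cong (λ x → expₛ x j - Y) (ℕ→ℚ-homo-+ 1 a) ⟨
      X - Y ∎

  ⟦derExpPoly⟧ : ∀ P → der ⟦ P ⟧ ≗ ⟦ derExpPoly P ⟧
  ⟦derExpPoly⟧ []            j = ℚP.*-zeroʳ (ℕ→ℚ (suc j))
  ⟦derExpPoly⟧ ((c , a) ∷ P) j = begin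
    ℕ→ℚ (suc j) * (ℤ→ℚ c * expₛ (ℕ→ℚ a) (suc j) + ⟦ P ⟧ (suc j))
      ≡⟨ solve 4 (λ n c e r → n :* (c :* e :+ r) := c :* (n :* e) :+ n :* r)
           refl (ℕ→ℚ (suc j)) (ℤ→ℚ c) (expₛ (ℕ→ℚ a) (suc j)) (⟦ P ⟧ (suc j)) ⟩
    ℤ→ℚ c * der (expₛ (ℕ→ℚ a)) j + der ⟦ P ⟧ j
      ≡⟨ cong₂ (λ x y → ℤ→ℚ c * x + y) (der-expₛ (ℕ→ℚ a) j) (⟦derExpPoly⟧ P j) ⟩
    ℤ→ℚ c * (ℕ→ℚ a * expₛ (ℕ→ℚ a) j) + ⟦ derExpPoly P ⟧ j
      ≡⟨ cong (_+ ⟦ derExpPoly P ⟧ j) (sym (ℚP.*-assoc (ℤ→ℚ c) (ℕ→ℚ a) (expₛ (ℕ→ℚ a) j))) ⟩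
    ℤ→ℚ c * ℕ→ℚ a * expₛ (ℕ→ℚ a) j + ⟦ derExpPoly P ⟧ j
      ≡⟨ cong (λ z → z * expₛ (ℕ→ℚ a) j + ⟦ derExpPoly P ⟧ j) (ℤ→ℚ-homo-* c (ℤ.+ a)) ⟨
    ⟦ derExpPoly ((c , a) ∷ P) ⟧ j ∎
    where open ≡-Reasoning

  liExpPoly : ℕ → ExpPoly
  liExpPoly zero    = (ℤ.+ 1 , 0) ∷ []
  liExpPoly (suc k) = derExpPoly (mulExpMinusOne (liExpPoly k))

  LiNegComp-closedForm : ∀ k → LiNegComp k ≗ expMinusOne ⊛ ⟦ liExpPoly k ⟧
  LiNegComp-closedForm zero j = begin
    LiNegComp 0 j                          ≡⟨ LiNegComp-zero j ⟩
    expMinusOne j                          ≡⟨ ⊛-identityʳ expMinusOne j ⟨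
    (expMinusOne ⊛ δ) j                    ≡⟨ ⊛-congʳ expMinusOne δ≗ j ⟩
    (expMinusOne ⊛ ⟦ liExpPoly 0 ⟧) j      ∎
    where
    open ≡-Reasoning
    δ≗ : δ ≗ ⟦ liExpPoly 0 ⟧
    δ≗ i = trans (sym (expₛ-0 i)) (solve 1 (λ x → x := con 1ℚ :* x :+ con 0ℚ) refl (expₛ 0ℚ i))
  LiNegComp-closedForm (suc k) j = begin
    LiNegComp (suc k) j                                             ≡⟨ LiNegComp-suc k j ⟩
    (expMinusOne ⊛ der (LiNegComp k)) j                             ≡⟨ ⊛-congʳ expMinusOne der≗ j ⟩
    (expMinusOne ⊛ ⟦ liExpPoly (suc k) ⟧) j                         ∎
    where
    open ≡-Reasoning
    der≗ : der (LiNegComp k) ≗ ⟦ liExpPoly (suc k) ⟧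
    der≗ i = trans (der-cong (λ i → trans (LiNegComp-closedForm k i) (⟦mulExpMinusOne⟧ (liExpPoly k) i)) i)
                   (⟦derExpPoly⟧ (mulExpMinusOne (liExpPoly k)) i)

  -- Division by e^t − 1 and the closed form of C^{(−k)}_n

  private
    revPrefix : Series → ℕ → List ℚ
    revPrefix F zero    = F 0 ∷ []
    revPrefix F (suc j) = F (suc j) ∷ revPrefix F j

    sumℚ-zipWith-revPrefix : ∀ F j (g : ℕ → ℚ) →
      sumℚ (zipWith _*_ (applyUpTo g (suc j)) (revPrefix F j)) ≡ Σ≤ j (λ i → g i * F (j ℕ.∸ i))
    sumℚ-zipWith-revPrefix F zero    g = ℚP.+-identityʳ (g 0 * F 0)
    sumℚ-zipWith-revPrefix F (suc j) g = trans (cong (g 0 * F (suc j) +_) (sumℚ-zipWith-revPrefix F j (g ∘ suc)))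
      (sym (Σ≤-head j (λ i → g i * F (suc j ℕ.∸ i))))

  divByExpMinusOne-⊛ : ∀ {G} F → G ≗ expMinusOne ⊛ F → divByExpMinusOne G ≗ F
  divByExpMinusOne-⊛ {G} F G≗ j = trans (cong head0 (divRev≡revPrefix j)) (head-revPrefix j)
    where
    open ≡-Reasoning
    G-suc : ∀ j → G (suc j) ≡ Σ≤ j (λ i → E i * F (j ℕ.∸ i))
    G-suc j = begin
      G (suc j)
        ≡⟨ G≗ (suc j) ⟩
      (expMinusOne ⊛ F) (suc j)
        ≡⟨ Σ≤-head j (λ i → expMinusOne i * F (suc j ℕ.∸ i)) ⟩
      0ℚ * F (suc j) + Σ≤ j (λ i → expMinusOne (suc i) * F (j ℕ.∸ i))
        ≡⟨ cong₂ _+_ (ℚP.*-zeroˡ (F (suc j))) (Σ≤-cong j (λ i _ → cong (_* F (j ℕ.∸ i)) (expMinusOne-suc i))) ⟩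
      0ℚ + Σ≤ j (λ i → E i * F (j ℕ.∸ i))
        ≡⟨ ℚP.+-identityˡ _ ⟩
      Σ≤ j (λ i → E i * F (j ℕ.∸ i)) ∎
    divRev≡revPrefix : ∀ j → divRev G j ≡ revPrefix F j
    divRev≡revPrefix zero    = cong (_∷ []) (trans (G-suc 0) (ℚP.*-identityˡ (F 0)))
    divRev≡revPrefix (suc j) = cong₂ _∷_ newest (divRev≡revPrefix j)
      where
      S = Σ≤ j (λ i → E (suc i) * F (j ℕ.∸ i))
      newest : G (suc (suc j)) - sumℚ (zipWith _*_ (map (E ∘ suc) (upTo (suc j))) (divRev G j)) ≡ F (suc j)
      newest = begin
        G (suc (suc j)) - sumℚ (zipWith _*_ (map (E ∘ suc) (upTo (suc j))) (divRev G j))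
          ≡⟨ cong₂ (λ x l → x - sumℚ (zipWith _*_ l (divRev G j)))
                   (G-suc (suc j)) (List.map-applyUpTo id (E ∘ suc) (suc j)) ⟩
        Σ≤ (suc j) (λ i → E i * F (suc j ℕ.∸ i)) - sumℚ (zipWith _*_ (applyUpTo (E ∘ suc) (suc j)) (divRev G j))
          ≡⟨ cong₂ _-_ (Σ≤-head j (λ i → E i * F (suc j ℕ.∸ i)))
                       (trans (cong (λ l → sumℚ (zipWith _*_ (applyUpTo (E ∘ suc) (suc j)) l)) (divRev≡revPrefix j))
                              (sumℚ-zipWith-revPrefix F j (E ∘ suc))) ⟩
        E 0 * F (suc j) + S - S
          ≡⟨ solve 2 (λ f s → con 1ℚ :* f :+ s :- s := f) refl (F (suc j)) S ⟩
        F (suc j) ∎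
    head-revPrefix : ∀ j → head0 (revPrefix F j) ≡ F j
    head-revPrefix zero    = refl
    head-revPrefix (suc j) = refl

  n!*⟦P⟧[n]≡powerSum : ∀ P n → ℕ→ℚ (n !) * ⟦ P ⟧ n ≡ ℤ→ℚ (powerSum P n)
  n!*⟦P⟧[n]≡powerSum []            n = ℚP.*-zeroʳ (ℕ→ℚ (n !))
  n!*⟦P⟧[n]≡powerSum ((c , a) ∷ P) n = begin
    ℕ→ℚ (n !) * (ℤ→ℚ c * (ℕ→ℚ a ^ n * invFact n) + ⟦ P ⟧ n)
      ≡⟨ solve 5 (λ f c p i e → f :* (c :* (p :* i) :+ e) := c :* p :* (f :* i) :+ f :* e)
           refl (ℕ→ℚ (n !)) (ℤ→ℚ c) (ℕ→ℚ a ^ n) (invFact n) (⟦ P ⟧ n) ⟩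
    ℤ→ℚ c * ℕ→ℚ a ^ n * (ℕ→ℚ (n !) * invFact n) + ℕ→ℚ (n !) * ⟦ P ⟧ n
      ≡⟨ cong₂ (λ x y → ℤ→ℚ c * ℕ→ℚ a ^ n * x + y) (n!*invFact[n]≡1 n) (n!*⟦P⟧[n]≡powerSum P n) ⟩
    ℤ→ℚ c * ℕ→ℚ a ^ n * 1ℚ + ℤ→ℚ (powerSum P n)
      ≡⟨ cong (_+ ℤ→ℚ (powerSum P n)) (trans (ℚP.*-identityʳ _) (cong (ℤ→ℚ c *_) (sym (ℤ→ℚ-homo-^ (ℤ.+ a) n)))) ⟩
    ℤ→ℚ c * ℤ→ℚ ((ℤ.+ a) ℤ.^ n) + ℤ→ℚ (powerSum P n)
      ≡⟨ trans (ℤ→ℚ-homo-+ (c ℤ.* (ℤ.+ a) ℤ.^ n) (powerSum P n))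
               (cong (_+ ℤ→ℚ (powerSum P n)) (ℤ→ℚ-homo-* c ((ℤ.+ a) ℤ.^ n))) ⟨
    ℤ→ℚ (powerSum ((c , a) ∷ P) n) ∎
    where open ≡-Reasoning

  polyBernoulliC-closedForm : ∀ k n → polyBernoulliC k n ≡ ℤ→ℚ (powerSum (liExpPoly k) n)
  polyBernoulliC-closedForm k n =
    trans (cong (ℕ→ℚ (n !) *_) (divByExpMinusOne-⊛ ⟦ liExpPoly k ⟧ (LiNegComp-closedForm k) n))
          (n!*⟦P⟧[n]≡powerSum (liExpPoly k) n)

  polyBernoulliC-sub : ∀ k n m → polyBernoulliC k n - polyBernoulliC k m
                       ≡ ℤ→ℚ (powerSum (liExpPoly k) n ℤ.- powerSum (liExpPoly k) m)
  polyBernoulliC-sub k n m = trans (cong₂ _-_ (polyBernoulliC-closedForm k n) (polyBernoulliC-closedForm k m))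
    (sym (ℤ→ℚ-homo-- (powerSum (liExpPoly k) n) (powerSum (liExpPoly k) m)))

open import Data.Nat using (ℕ; _≥_; _^_)
open import Data.Nat.Primality using (Prime)
open import Data.Integer using (ℤ; +_; _-_)
open import Data.Integer.Divisibility using (_∣_)
open import Data.Integer.Divisibility.Signed using (divides)
open import Data.Rational using (_*_; _-_)
import Data.Rational.Properties as ℚP
open import Data.Product using (∃)
open PrimePowerCongruences using (^-≡-mod-prime-power; ∣-powerSum)
open PolyBernoulliClosedForm using (liExpPoly; polyBernoulliC-sub; ℤ→ℚ-homo-*)

theorem2p4 : (p k N n m : ℕ) → Prime p → k ≥ 1 → N ≥ 1 → n ≥ N → m ≥ N →
    (+ φ (p ^ N)) ∣ (+ n Data.Integer.- + m) →
    ∃ λ (z : ℤ) →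
      polyBernoulliC k n Data.Rational.- polyBernoulliC k m
        ≡ ℤ→ℚ (+ (p ^ N)) Data.Rational.* ℤ→ℚ z
theorem2p4 p k N n m pp _ _ n≥N m≥N φ∣n-m
  with ∣-powerSum (^-≡-mod-prime-power pp m≥N n≥N φ∣n-m) (liExpPoly k)
... | divides z powerSum-diff≡z*p^N = z , (begin
  polyBernoulliC k n Data.Rational.- polyBernoulliC k m
    ≡⟨ polyBernoulliC-sub k n m ⟩
  ℤ→ℚ (powerSum (liExpPoly k) n ℤ.- powerSum (liExpPoly k) m)
    ≡⟨ cong ℤ→ℚ powerSum-diff≡z*p^N ⟩
  ℤ→ℚ (z ℤ.* + (p ^ N))
    ≡⟨ ℤ→ℚ-homo-* z (+ (p ^ N)) ⟩
  ℤ→ℚ z Data.Rational.* ℤ→ℚ (+ (p ^ N))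
    ≡⟨ ℚP.*-comm (ℤ→ℚ z) (ℤ→ℚ (+ (p ^ N))) ⟩
  ℤ→ℚ (+ (p ^ N)) Data.Rational.* ℤ→ℚ z ∎)
  where open ≡-Reasoning
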